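{- For every $\varepsilon>0$ there exists an integer $C(\varepsilon)\ge3$ such that for all integers $d\ge C(\varepsilon)$ and $N\ge C(\varepsilon)d$, \[ \frac{1}{\#\Psi}\cdot\#\left\{(\vec{\mathbf v},\vec{\mathbf w})\in\Psi:\ \sin\big(\widehat{\vec{\mathbf v},\vec{\mathbf w}}\big)\in\left[\tfrac{\sqrt7}{4}-\varepsilon,\ \tfrac{\sqrt7}{4}+\varepsilon\right]\right\}\ge1-\varepsilon, \] where $\widehat{\vec{\mathbf v},\vec{\mathbf w}}$ denotes the angle between the two rays.
   Context: For integers $d,N\ge1$ let $\mathcal W=[0,N]^d\cap\mathbb Z^d$. Two points $\mathbf v,\mathbf w\in\mathcal W$ are visible from each other if $\gcd(v_1-w_1,\dots,v_d-w_d)=1$, and $\Omega$ is the set of ordered pairs $(\mathbf v,\mathbf w)\in\mathcal W\times\mathcal W$ of points visible from each other. For $\mathbf v\in\mathcal W$, $\vec{\mathbf v}$ denotes the ray starting at the origin and passing through $\mathbf v$. $\Psi$ is the set of pairs of rays $(\vec{\mathbf v},\vec{\mathbf w})$ with $(\mathbf v,\mathbf w)\in\Omega$.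
   Formalization: The parameter ε ranges over the positive rationals. -}

module Defs where

open import Data.Nat as ℕ using (ℕ; zero; suc; _+_; _*_; _<_; ∣_-_∣)
open import Data.Nat.GCD using (gcd)
open import Data.Integer as ℤ using (ℤ; +_)
open import Data.Rational as ℚ using (ℚ; 0ℚ; 1ℚ; _/_; _≤_)
open import Data.Rational.Properties as ℚP using ()
open import Data.Product using (_×_; _,_; proj₁; proj₂)
open import Data.List using (List; []; _∷_; map; concatMap; upTo; length; filter; cartesianProduct)
open import Data.List.Relation.Unary.Any as Any using (Any)
open import Data.Vec as Vec using (Vec; []; _∷_; foldr; zipWith)
open import Data.Vec.Properties as VecP using ()
open import Relation.Binary.PropositionalEquality using (_≡_)
open import Relation.Nullary.Decidable using (Dec; _×-dec_)

-- Points of ℤ^d with non-negative coordinates are represented as Vec ℕ d.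
Pt : ℕ → Set
Pt d = Vec ℕ d

grid : (d N : ℕ) → List (Pt d)
grid zero    N = [] ∷ []
grid (suc d) N = concatMap (λ x → map (x ∷_) (grid d N)) (upTo (suc N))

-- gcd of all coordinates of a vector (gcd of the empty family is 0).
gcdVec : ∀ {d} → Pt d → ℕ
gcdVec = foldr (λ _ → ℕ) gcd 0

-- v and w are visible from each other: gcd(v₁-w₁,…,v_d-w_d) = 1.
-- (gcd is insensitive to signs, so we use absolute differences.)
Visible : ∀ {d} → Pt d → Pt d → Set
Visible v w = gcdVec (zipWith ∣_-_∣ v w) ≡ 1

visible? : ∀ {d} (v w : Pt d) → Dec (Visible v w)
visible? v w = gcdVec (zipWith ∣_-_∣ v w) ℕ.≟ 1

Ω : (d N : ℕ) → List (Pt d × Pt d)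
Ω d N = filter (λ vw → visible? (proj₁ vw) (proj₂ vw)) (cartesianProduct (grid d N) (grid d N))

-- A ray from the origin through a nonzero v ∈ ℕ^d is represented by
-- its unique primitive direction vector p (gcd of coordinates = 1):
-- v lies on the ray with direction p iff v is a positive multiple of p,
-- i.e. v = gcd(v)·p with gcd(v) > 0.
Primitive : ∀ {d} → Pt d → Set
Primitive p = gcdVec p ≡ 1

primitive? : ∀ {d} (p : Pt d) → Dec (Primitive p)
primitive? p = gcdVec p ℕ.≟ 1

OnRay : ∀ {d} → Pt d → Pt d → Set
OnRay p v = (v ≡ Vec.map (gcdVec v *_) p) × (0 < gcdVec v)

onRay? : ∀ {d} (p v : Pt d) → Dec (OnRay p v)
onRay? p v = VecP.≡-dec ℕ._≟_ v (Vec.map (gcdVec v *_) p) ×-dec (0 ℕ.<? gcdVec v)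

-- Ψ : pairs of rays (v⃗, w⃗) with (v,w) ∈ Ω (v, w ≠ 0 so the rays exist),
-- each pair of rays listed exactly once, via its primitive direction vectors.
-- (Primitive direction vectors of points of 𝒲 lie again in 𝒲.)
InΨ : ∀ {d} (N : ℕ) → Pt d × Pt d → Set
InΨ {d} N (p , q) =
  Primitive p × Primitive q ×
  Any (λ vw → OnRay p (proj₁ vw) × OnRay q (proj₂ vw)) (Ω d N)

inΨ? : ∀ {d} (N : ℕ) (pq : Pt d × Pt d) → Dec (InΨ N pq)
inΨ? {d} N (p , q) =
  primitive? p ×-dec primitive? q ×-dec
  Any.any? (λ vw → onRay? p (proj₁ vw) ×-dec onRay? q (proj₂ vw)) (Ω d N)

Ψ : (d N : ℕ) → List (Pt d × Pt d)
Ψ d N = filter (inΨ? N) (cartesianProduct (grid d N) (grid d N))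

dot : ∀ {d} → Pt d → Pt d → ℕ
dot v w = foldr (λ _ → ℕ) _+_ 0 (zipWith _*_ v w)

-- sin² of the angle θ between the rays through p and q (nonzero):
-- cos θ = ⟨p,q⟩ / (|p| |q|),  sin² θ = 1 - ⟨p,q⟩² / (|p|² |q|²).
-- (The zero case of |p|²|q|² never occurs for rays; it is given value 0.)
sinSq : ∀ {d} → Pt d → Pt d → ℚ
sinSq p q with dot p p * dot q q
... | zero  = 0ℚ
... | suc k = 1ℚ ℚ.- ((+ (dot p q * dot p q)) / suc k)

-- For t ≥ 0 and ε > 0:
--   √t ∈ [√7/4 - ε, √7/4 + ε]   ⇔   (t + ε² - 7/16)² ≤ 4 ε² t .
-- (Indeed with s = √t, a = √7/4:
--  (s²+ε²-a²)² - 4ε²s² = ((s-ε)² - a²)((s+ε)² - a²), which is ≤ 0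
--  iff |s-ε| ≤ a ≤ s+ε iff |s-a| ≤ ε.)
-- This is the exact, irrational-free rendering of
--   sin θ ∈ [√7/4 - ε, √7/4 + ε]   with  t = sin² θ.
SqrtNear√7/4 : ℚ → ℚ → Set
SqrtNear√7/4 t ε = u ℚ.* u ≤ (+ 4 / 1) ℚ.* ε ℚ.* ε ℚ.* t
  where u = t ℚ.+ ε ℚ.* ε ℚ.- (+ 7 / 16)

sqrtNear? : ∀ t ε → Dec (SqrtNear√7/4 t ε)
sqrtNear? t ε = _ ℚP.≤? _

goodΨ : (d N : ℕ) → ℚ → List (Pt d × Pt d)
goodΨ d N ε = filter (λ pq → sqrtNear? (sinSq (proj₁ pq) (proj₂ pq)) ε) (Ψ d N)

ℕ→ℚ : ℕ → ℚ
ℕ→ℚ n = + n / 1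

module Submission where

-- Regard (p, q) as a uniformly random pair of points of 𝒲 = [0,N]^d.  The quantities 6|p|², 6|q|²
-- and 4⟨p,q⟩ are sums of d independent coordinate terms with means N(2N+1), N(2N+1) and N², and
-- their variances are O(dN⁴).  By Chebyshev, outside O(m²/d)·|𝒲|² pairs all three lie within
-- dN²/m of their means, and then cos² = ⟨p,q⟩²/(|p|²|q|²) is within O(1/m) of (1/4)²/(1/3)² = 9/16,
-- so the sine is close to √7/4.  These exceptional pairs are few compared with Ψ: a pair of grid
-- points (p, q) with p, q and p − q primitive is itself a pair of rays in Ψ, and for each of the
-- three conditions the failing pairs number at most Σ_{g ≥ 2} ((N + g)/g)^d·|𝒲| ≤ |𝒲|²/6, so
-- |Ψ| ≥ |𝒲|²/2.

open import Level using (0ℓ)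
open import Algebra.Bundles using (CommutativeSemiring)
open import Data.Nat using (suc)
open import Data.List using (List; []; _∷_; _++_; _∷ʳ_; map; concatMap; filter; length; cartesianProduct; upTo; iterate)
open import Data.Vec using (Vec; []; _∷_; zipWith; replicate)
import Data.Vec as Vec
open import Data.Product using (_×_; _,_; proj₁; proj₂; ∃-syntax)
open import Data.Sum using (_⊎_; inj₁; inj₂)
open import Function using (_∘_)
open import Data.Empty using (⊥-elim)
open import Defs

module ListSum (R : CommutativeSemiring 0ℓ 0ℓ) where
  open CommutativeSemiring R
  open import Algebra.Properties.CommutativeSemigroup +-commutativeSemigroup using (interchange)
  open import Relation.Binary.Reasoning.Setoid setoid

  private variable
    A B : Set

  ∑ : List A → (A → Carrier) → Carrier
  ∑ []       f = 0#
  ∑ (x ∷ xs) f = f x + ∑ xs f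

  syntax ∑ xs (λ x → e) = ∑[ x ∈ xs ] e

  ∑-cong : ∀ xs {f g : A → Carrier} → (∀ x → f x ≈ g x) → ∑ xs f ≈ ∑ xs g
  ∑-cong []       f≈g = refl
  ∑-cong (x ∷ xs) f≈g = +-cong (f≈g x) (∑-cong xs f≈g)

  ∑-++ : ∀ xs ys (f : A → Carrier) → ∑ (xs ++ ys) f ≈ ∑ xs f + ∑ ys f
  ∑-++ []       ys f = sym (+-identityˡ _)
  ∑-++ (x ∷ xs) ys f = trans (+-congˡ (∑-++ xs ys f)) (sym (+-assoc _ _ _))

  ∑-map : ∀ (g : A → B) xs (f : B → Carrier) → ∑ (map g xs) f ≈ ∑ xs (f ∘ g)
  ∑-map g []       f = refl
  ∑-map g (x ∷ xs) f = +-congˡ (∑-map g xs f)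

  ∑-concatMap : ∀ (g : A → List B) xs (f : B → Carrier) → ∑ (concatMap g xs) f ≈ ∑[ x ∈ xs ] ∑ (g x) f
  ∑-concatMap g []       f = refl
  ∑-concatMap g (x ∷ xs) f = trans (∑-++ (g x) _ f) (+-congˡ (∑-concatMap g xs f))

  ∑-cartesianProduct : ∀ (xs : List A) (ys : List B) f →
    ∑ (cartesianProduct xs ys) f ≈ ∑[ x ∈ xs ] ∑[ y ∈ ys ] f (x , y)
  ∑-cartesianProduct []       ys f = refl
  ∑-cartesianProduct (x ∷ xs) ys f =
    trans (∑-++ (map (x ,_) ys) _ f) (+-cong (∑-map (x ,_) ys f) (∑-cartesianProduct xs ys f))

  ∑-grid : ∀ d N (f : Pt (suc d) → Carrier) →
    ∑ (grid (suc d) N) f ≈ ∑[ x ∈ upTo (suc N) ] ∑[ p ∈ grid d N ] f (x ∷ p)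
  ∑-grid d N f = trans (∑-concatMap (λ x → map (x ∷_) (grid d N)) (upTo (suc N)) f)
                       (∑-cong (upTo (suc N)) (λ x → ∑-map (x ∷_) (grid d N) f))

  ∑-zero : ∀ (xs : List A) → ∑[ x ∈ xs ] 0# ≈ 0#
  ∑-zero []       = refl
  ∑-zero (x ∷ xs) = trans (+-identityˡ _) (∑-zero xs)

  ∑-distrib-+ : ∀ xs (f g : A → Carrier) → ∑[ x ∈ xs ] (f x + g x) ≈ ∑ xs f + ∑ xs g
  ∑-distrib-+ []       f g = sym (+-identityˡ 0#)
  ∑-distrib-+ (x ∷ xs) f g = trans (+-congˡ (∑-distrib-+ xs f g)) (interchange _ _ _ _)

  ∑-distribˡ : ∀ xs k (f : A → Carrier) → ∑[ x ∈ xs ] (k * f x) ≈ k * ∑ xs f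
  ∑-distribˡ []       k f = sym (zeroʳ k)
  ∑-distribˡ (x ∷ xs) k f = trans (+-congˡ (∑-distribˡ xs k f)) (sym (distribˡ k _ _))

  ∑-comm : ∀ (xs : List A) (ys : List B) (f : A → B → Carrier) → ∑[ x ∈ xs ] ∑[ y ∈ ys ] f x y ≈ ∑[ y ∈ ys ] ∑[ x ∈ xs ] f x y
  ∑-comm []       ys f = sym (∑-zero ys)
  ∑-comm (x ∷ xs) ys f = trans (+-congˡ (∑-comm xs ys f)) (sym (∑-distrib-+ ys (f x) _))

module Rational where
  open import Data.Nat as ℕ using (ℕ; zero; suc)
  import Data.Nat.Properties as ℕP
  open import Data.Integer as ℤ using (ℤ; +_; -[1+_])
  import Data.Integer.Properties as ℤP
  import Data.Integer.Tactic.RingSolver as ℤ-Ring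
  open import Data.Rational as ℚ using (ℚ; 0ℚ; 1ℚ; _+_; _*_; _-_; _≤_; _<_; _/_; mkℚ; toℚᵘ; positive; nonNegative)
  open import Data.Rational.Properties
  open import Data.Rational.Unnormalised as ℚᵘ using (mkℚᵘ; *≡*)
  import Data.Rational.Unnormalised.Properties as ℚᵘP
  open import Data.Rational.Solver using (module +-*-Solver)
  open import Data.Nat.Coprimality using (1-coprimeTo) renaming (sym to coprime-sym)
  open import Relation.Binary.PropositionalEquality using (_≡_; refl; cong; cong₂; subst; subst₂; module ≡-Reasoning)
    renaming (sym to ≡-sym; trans to ≡-trans)
  open import Data.Empty using (⊥-elim)

  ℕ→ℚ≡mkℚ : ∀ n → ℕ→ℚ n ≡ mkℚ (+ n) 0 (coprime-sym (1-coprimeTo n))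
  ℕ→ℚ≡mkℚ n = normalize-coprime (coprime-sym (1-coprimeTo n))

  toℚᵘ-ℕ→ℚ : ∀ n → toℚᵘ (ℕ→ℚ n) ℚᵘ.≃ mkℚᵘ (+ n) 0
  toℚᵘ-ℕ→ℚ n = toℚᵘ-fromℚᵘ (mkℚᵘ (+ n) 0)

  ℕ→ℚ-+ : ∀ a b → ℕ→ℚ (a ℕ.+ b) ≡ ℕ→ℚ a + ℕ→ℚ b
  ℕ→ℚ-+ a b = toℚᵘ-injective (ℚᵘP.≃-trans (toℚᵘ-ℕ→ℚ (a ℕ.+ b)) (ℚᵘP.≃-sym (ℚᵘP.≃-trans (toℚᵘ-homo-+ (ℕ→ℚ a) (ℕ→ℚ b))
    (ℚᵘP.≃-trans (ℚᵘP.+-cong (toℚᵘ-ℕ→ℚ a) (toℚᵘ-ℕ→ℚ b)) (*≡* cross)))))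
    where
    cross : (+ a ℤ.* + 1 ℤ.+ + b ℤ.* + 1) ℤ.* + 1 ≡ + (a ℕ.+ b) ℤ.* + 1
    cross = ≡-trans (unit-cross (+ a) (+ b)) (cong (ℤ._* + 1) (≡-sym (ℤP.pos-+ a b)))
      where
      unit-cross : ∀ x y → (x ℤ.* + 1 ℤ.+ y ℤ.* + 1) ℤ.* + 1 ≡ (x ℤ.+ y) ℤ.* + 1
      unit-cross = ℤ-Ring.solve-∀

  ℕ→ℚ-* : ∀ a b → ℕ→ℚ (a ℕ.* b) ≡ ℕ→ℚ a * ℕ→ℚ b
  ℕ→ℚ-* a b = toℚᵘ-injective (ℚᵘP.≃-trans (toℚᵘ-ℕ→ℚ (a ℕ.* b)) (ℚᵘP.≃-sym (ℚᵘP.≃-trans (toℚᵘ-homo-* (ℕ→ℚ a) (ℕ→ℚ b))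
    (ℚᵘP.≃-trans (ℚᵘP.*-cong (toℚᵘ-ℕ→ℚ a) (toℚᵘ-ℕ→ℚ b)) (*≡* (cong (ℤ._* + 1) (≡-sym (ℤP.pos-* a b))))))))

  ℕ→ℚ-mono-≤ : ∀ {a b} → a ℕ.≤ b → ℕ→ℚ a ≤ ℕ→ℚ b
  ℕ→ℚ-mono-≤ {a} {b} a≤b rewrite ℕ→ℚ≡mkℚ a | ℕ→ℚ≡mkℚ b =
    ℚ.*≤* (subst₂ ℤ._≤_ (≡-sym (ℤP.*-identityʳ (+ a))) (≡-sym (ℤP.*-identityʳ (+ b))) (ℤ.+≤+ a≤b))

  ℕ→ℚ-pos : ∀ n .{{_ : ℕ.NonZero n}} → 0ℚ < ℕ→ℚ n
  ℕ→ℚ-pos (suc k) rewrite ℕ→ℚ≡mkℚ (suc k) = ℚ.*<* (subst (ℤ._<_ (+ 0)) (≡-sym (ℤP.*-identityʳ (+ suc k))) (ℤ.+<+ (ℕ.s≤s ℕ.z≤n)))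

  /-*-cancel : ∀ n k → (+ n / suc k) * ℕ→ℚ (suc k) ≡ ℕ→ℚ n
  /-*-cancel n k = toℚᵘ-injective (ℚᵘP.≃-trans (toℚᵘ-homo-* (+ n / suc k) (ℕ→ℚ (suc k)))
    (ℚᵘP.≃-trans (ℚᵘP.*-cong (toℚᵘ-fromℚᵘ (mkℚᵘ (+ n) k)) (toℚᵘ-ℕ→ℚ (suc k)))
    (ℚᵘP.≃-trans (*≡* cross) (ℚᵘP.≃-sym (toℚᵘ-ℕ→ℚ n)))))
    where
    cross : (+ n ℤ.* + suc k) ℤ.* + 1 ≡ + n ℤ.* + (suc k ℕ.* 1)
    cross rewrite ℕP.*-identityʳ (suc k) = ℤP.*-identityʳ (+ n ℤ.* + suc k)

  p≤q⇒0≤q-p : ∀ {p q} → p ≤ q → 0ℚ ≤ q - p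
  p≤q⇒0≤q-p {p} {q} p≤q = ≤-trans (≤-reflexive (≡-sym (+-inverseʳ p))) (+-monoˡ-≤ (ℚ.- p) p≤q)

  0≤p*q : ∀ {p q} → 0ℚ ≤ p → 0ℚ ≤ q → 0ℚ ≤ p * q
  0≤p*q {p} {q} 0≤p 0≤q = ≤-trans (≤-reflexive (≡-sym (*-zeroˡ q))) (*-monoʳ-≤-nonNeg q {{nonNegative 0≤q}} 0≤p)

  0≤p+q : ∀ {p q} → 0ℚ ≤ p → 0ℚ ≤ q → 0ℚ ≤ p + q
  0≤p+q = +-mono-≤

  ≤-by-slack : ∀ {p q} r → 0ℚ ≤ r → p + r ≡ q → p ≤ q
  ≤-by-slack {p} r 0≤r p+r≡q = ≤-trans (≤-reflexive (≡-sym (+-identityʳ p))) (≤-trans (+-monoʳ-≤ p 0≤r) (≤-reflexive p+r≡q))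

  0≤+n/d : ∀ n k → 0ℚ ≤ + n / suc k
  0≤+n/d n k = nonNegative⁻¹ _ {{normalize-nonNeg n (suc k)}}

  -- The hypotheses say |t − 7/16| ≤ ε²/10; the slack is a nonnegative certificate for
  -- 4ε²t − (t + ε² − 7/16)², where the term E(1 − E) uses ε ≤ 1.
  sqrtNear√7/4-of-close : ∀ ε t → 0ℚ ≤ ε → ε ≤ 1ℚ →
    0ℚ ≤ ε * ε - + 10 / 1 * (t - + 7 / 16) → 0ℚ ≤ ε * ε + + 10 / 1 * (t - + 7 / 16) →
    SqrtNear√7/4 t ε
  sqrtNear√7/4-of-close ε t 0≤ε ε≤1 0≤a 0≤b = ≤-by-slack slack 0≤slack identity
    where
    open +-*-Solver
    E = ε * ε
    a = E - + 10 / 1 * (t - + 7 / 16)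
    b = E + + 10 / 1 * (t - + 7 / 16)
    0≤E : 0ℚ ≤ E
    0≤E = 0≤p*q 0≤ε 0≤ε
    0≤1-E : 0ℚ ≤ 1ℚ - E
    0≤1-E = p≤q⇒0≤q-p (≤-trans (*-monoˡ-≤-nonNeg ε {{nonNegative 0≤ε}} ε≤1)
                                (≤-trans (≤-reflexive (*-identityʳ ε)) ε≤1))
    slack = + 1 / 100 * (a * b) + (+ 1 / 5 * E * b + (+ 121 / 100 * E * (1ℚ - E) + + 54 / 100 * E))
    0≤slack : 0ℚ ≤ slack
    0≤slack = 0≤p+q (0≤p*q (0≤+n/d 1 99) (0≤p*q 0≤a 0≤b))
             (0≤p+q (0≤p*q (0≤p*q (0≤+n/d 1 4) 0≤E) 0≤b)
             (0≤p+q (0≤p*q (0≤p*q (0≤+n/d 121 99) 0≤E) 0≤1-E) (0≤p*q (0≤+n/d 54 99) 0≤E)))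
    identity : (t + E - + 7 / 16) * (t + E - + 7 / 16) + slack ≡ + 4 / 1 * ε * ε * t
    identity = solve 2 (λ ε t →
        (t :+ ε :* ε :- con (+ 7 / 16)) :* (t :+ ε :* ε :- con (+ 7 / 16))
        :+ (con (+ 1 / 100) :* ((ε :* ε :- con (+ 10 / 1) :* (t :- con (+ 7 / 16))) :* (ε :* ε :+ con (+ 10 / 1) :* (t :- con (+ 7 / 16))))
           :+ (con (+ 1 / 5) :* (ε :* ε) :* (ε :* ε :+ con (+ 10 / 1) :* (t :- con (+ 7 / 16)))
              :+ (con (+ 121 / 100) :* (ε :* ε) :* (con 1ℚ :- ε :* ε) :+ con (+ 54 / 100) :* (ε :* ε))))
        := con (+ 4 / 1) :* ε :* ε :* t) refl ε t

  sqrtNear√7/4-of-cos² : ∀ ε Λ x → 0ℚ ≤ ε → ε ≤ 1ℚ → 0ℚ < Λ → + 10 / 1 ≤ ε * ε * Λ →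
    + 16 / 1 * Λ * x ≤ + 9 / 1 * Λ + + 16 / 1 → + 9 / 1 * Λ ≤ + 16 / 1 * Λ * x + + 16 / 1 →
    SqrtNear√7/4 (1ℚ - x) ε
  sqrtNear√7/4-of-cos² ε Λ x 0≤ε ε≤1 0<Λ 10≤εεΛ upper lower = sqrtNear√7/4-of-close ε (1ℚ - x) 0≤ε ε≤1 0≤a 0≤b
    where
    open +-*-Solver
    U = p≤q⇒0≤q-p upper
    W = p≤q⇒0≤q-p lower
    Z = p≤q⇒0≤q-p 10≤εεΛ
    cancel16Λ : ∀ r → 0ℚ ≤ + 16 / 1 * Λ * r → 0ℚ ≤ r
    cancel16Λ r 0≤16Λr = *-cancelˡ-≤-pos (+ 16 / 1 * Λ) {{positive (*-monoʳ-<-pos (+ 16 / 1) 0<Λ)}}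
                           (≤-trans (≤-reflexive (*-zeroʳ (+ 16 / 1 * Λ))) 0≤16Λr)
    0≤a : 0ℚ ≤ ε * ε - + 10 / 1 * ((1ℚ - x) - + 7 / 16)
    0≤a = cancel16Λ _ (≤-trans (0≤p+q (0≤p*q (0≤+n/d 16 0) Z) (0≤p*q (0≤+n/d 10 0) W)) (≤-reflexive (via-W ε x Λ)))
      where
      via-W : ∀ ε x Λ → + 16 / 1 * (ε * ε * Λ - + 10 / 1) + + 10 / 1 * (+ 16 / 1 * Λ * x + + 16 / 1 - + 9 / 1 * Λ)
                      ≡ + 16 / 1 * Λ * (ε * ε - + 10 / 1 * ((1ℚ - x) - + 7 / 16))
      via-W = solve 3 (λ ε x Λ →
          con (+ 16 / 1) :* (ε :* ε :* Λ :- con (+ 10 / 1)) :+ con (+ 10 / 1) :* (con (+ 16 / 1) :* Λ :* x :+ con (+ 16 / 1) :- con (+ 9 / 1) :* Λ)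
        := con (+ 16 / 1) :* Λ :* (ε :* ε :- con (+ 10 / 1) :* ((con 1ℚ :- x) :- con (+ 7 / 16)))) refl
    0≤b : 0ℚ ≤ ε * ε + + 10 / 1 * ((1ℚ - x) - + 7 / 16)
    0≤b = cancel16Λ _ (≤-trans (0≤p+q (0≤p*q (0≤+n/d 16 0) Z) (0≤p*q (0≤+n/d 10 0) U)) (≤-reflexive (via-U ε x Λ)))
      where
      via-U : ∀ ε x Λ → + 16 / 1 * (ε * ε * Λ - + 10 / 1) + + 10 / 1 * (+ 9 / 1 * Λ + + 16 / 1 - + 16 / 1 * Λ * x)
                      ≡ + 16 / 1 * Λ * (ε * ε + + 10 / 1 * ((1ℚ - x) - + 7 / 16))
      via-U = solve 3 (λ ε x Λ →
          con (+ 16 / 1) :* (ε :* ε :* Λ :- con (+ 10 / 1)) :+ con (+ 10 / 1) :* (con (+ 9 / 1) :* Λ :+ con (+ 16 / 1) :- con (+ 16 / 1) :* Λ :* x)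
        := con (+ 16 / 1) :* Λ :* (ε :* ε :+ con (+ 10 / 1) :* ((con 1ℚ :- x) :- con (+ 7 / 16)))) refl

  -- The ℕ hypotheses are |⟨p,q⟩²/(|p|²|q|²) − 9/16| ≤ 1/L with the denominators cleared.
  sqrtNear√7/4-sinSq : ∀ ε L .{{_ : ℕ.NonZero L}} {d} (p q : Pt d) → 0ℚ ≤ ε → ε ≤ 1ℚ → ℕ→ℚ 10 ≤ ε * ε * ℕ→ℚ L →
    1 ℕ.≤ dot p p ℕ.* dot q q →
    16 ℕ.* L ℕ.* (dot p q ℕ.* dot p q) ℕ.≤ (9 ℕ.* L ℕ.+ 16) ℕ.* (dot p p ℕ.* dot q q) →
    9 ℕ.* L ℕ.* (dot p p ℕ.* dot q q) ℕ.≤ 16 ℕ.* L ℕ.* (dot p q ℕ.* dot p q) ℕ.+ 16 ℕ.* (dot p p ℕ.* dot q q) →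
    SqrtNear√7/4 (sinSq p q) ε
  sqrtNear√7/4-sinSq ε L p q 0≤ε ε≤1 10≤εεL 1≤AB upper lower with dot p p ℕ.* dot q q
  ... | zero   = ⊥-elim (ℕP.<-irrefl refl 1≤AB)
  ... | suc P′ = sqrtNear√7/4-of-cos² ε Λ x 0≤ε ε≤1 (ℕ→ℚ-pos L) 10≤εεL
                   (*-cancelʳ-≤-pos {p = + 16 / 1 * Λ * x} {q = + 9 / 1 * Λ + + 16 / 1} P {{positive 0<P}}
                     (subst₂ _≤_ ↑16LDD ↑[9L+16]P (ℕ→ℚ-mono-≤ upper)))
                   (*-cancelʳ-≤-pos {p = + 9 / 1 * Λ} {q = + 16 / 1 * Λ * x + + 16 / 1} P {{positive 0<P}}
                     (subst₂ _≤_ ↑9LP ↑16LDD+16P (ℕ→ℚ-mono-≤ lower)))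
    where
    DD = dot p q ℕ.* dot p q
    x = + DD / suc P′
    Λ = ℕ→ℚ L
    P = ℕ→ℚ (suc P′)
    0<P : 0ℚ < P
    0<P = ℕ→ℚ-pos (suc P′)
    ↑16LDD : ℕ→ℚ (16 ℕ.* L ℕ.* DD) ≡ + 16 / 1 * Λ * x * P
    ↑16LDD = begin
      ℕ→ℚ (16 ℕ.* L ℕ.* DD)           ≡⟨ ≡-trans (ℕ→ℚ-* (16 ℕ.* L) DD) (cong (_* ℕ→ℚ DD) (ℕ→ℚ-* 16 L)) ⟩
      + 16 / 1 * Λ * ℕ→ℚ DD            ≡⟨ cong (+ 16 / 1 * Λ *_) (/-*-cancel DD P′) ⟨
      + 16 / 1 * Λ * (x * P)           ≡⟨ *-assoc (+ 16 / 1 * Λ) x P ⟨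
      + 16 / 1 * Λ * x * P             ∎
      where open ≡-Reasoning
    ↑[9L+16]P : ℕ→ℚ ((9 ℕ.* L ℕ.+ 16) ℕ.* suc P′) ≡ (+ 9 / 1 * Λ + + 16 / 1) * P
    ↑[9L+16]P = ≡-trans (ℕ→ℚ-* (9 ℕ.* L ℕ.+ 16) (suc P′)) (cong (_* P) (≡-trans (ℕ→ℚ-+ (9 ℕ.* L) 16) (cong (_+ + 16 / 1) (ℕ→ℚ-* 9 L))))
    ↑9LP : ℕ→ℚ (9 ℕ.* L ℕ.* suc P′) ≡ + 9 / 1 * Λ * P
    ↑9LP = ≡-trans (ℕ→ℚ-* (9 ℕ.* L) (suc P′)) (cong (_* P) (ℕ→ℚ-* 9 L))
    ↑16LDD+16P : ℕ→ℚ (16 ℕ.* L ℕ.* DD ℕ.+ 16 ℕ.* suc P′) ≡ (+ 16 / 1 * Λ * x + + 16 / 1) * P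
    ↑16LDD+16P = begin
      ℕ→ℚ (16 ℕ.* L ℕ.* DD ℕ.+ 16 ℕ.* suc P′)  ≡⟨ ≡-trans (ℕ→ℚ-+ (16 ℕ.* L ℕ.* DD) (16 ℕ.* suc P′))
                                                           (cong₂ _+_ ↑16LDD (ℕ→ℚ-* 16 (suc P′))) ⟩
      + 16 / 1 * Λ * x * P + + 16 / 1 * P      ≡⟨ *-distribʳ-+ P (+ 16 / 1 * Λ * x) (+ 16 / 1) ⟨
      (+ 16 / 1 * Λ * x + + 16 / 1) * P        ∎
      where open ≡-Reasoning

  positive⇒1≤ε*denominator : ∀ ε → 0ℚ < ε → ∃[ k ] 1ℚ ≤ ε * ℕ→ℚ (suc k)
  positive⇒1≤ε*denominator ε@(mkℚ (+ suc n) k _) _ =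
    k , ≤-trans (ℕ→ℚ-mono-≤ {1} {suc n} (ℕ.s≤s ℕ.z≤n))
                (≤-reflexive (≡-sym (≡-trans (cong (_* ℕ→ℚ (suc k)) (≡-sym (↥p/↧p≡p ε))) (/-*-cancel (suc n) k))))
  positive⇒1≤ε*denominator (mkℚ (+ zero)  _ _) (ℚ.*<* (ℤ.+<+ ()))
  positive⇒1≤ε*denominator (mkℚ -[1+ _ ] _ _) (ℚ.*<* ())

  [1-ε]ψ≤γ-of-1≤ε : ∀ ε ψ γ → 1ℚ ≤ ε → (1ℚ - ε) * ℕ→ℚ ψ ≤ ℕ→ℚ γ
  [1-ε]ψ≤γ-of-1≤ε ε ψ γ 1≤ε = begin
    (1ℚ - ε) * ℕ→ℚ ψ  ≤⟨ *-monoʳ-≤-nonNeg (ℕ→ℚ ψ) {{nonNegative (ℕ→ℚ-mono-≤ {0} {ψ} ℕ.z≤n)}} 1-ε≤0 ⟩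
    0ℚ * ℕ→ℚ ψ        ≡⟨ *-zeroˡ (ℕ→ℚ ψ) ⟩
    0ℚ                ≤⟨ ℕ→ℚ-mono-≤ {0} {γ} ℕ.z≤n ⟩
    ℕ→ℚ γ             ∎
    where
    open ≤-Reasoning
    1-ε≤0 : 1ℚ - ε ≤ 0ℚ
    1-ε≤0 = ≤-trans (+-monoˡ-≤ (ℚ.- ε) 1≤ε) (≤-reflexive (+-inverseʳ ε))

  [1-ε]ψ≤γ : ∀ ε k ψ γ b → 0ℚ ≤ ε → 1ℚ ≤ ε * ℕ→ℚ k → ψ ℕ.≤ γ ℕ.+ b → k ℕ.* b ℕ.≤ ψ → (1ℚ - ε) * ℕ→ℚ ψ ≤ ℕ→ℚ γ
  [1-ε]ψ≤γ ε k ψ γ b 0≤ε 1≤εk ψ≤γ+b kb≤ψ = begin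
    (1ℚ - ε) * ℕ→ℚ ψ                      ≡⟨ distribute ε (ℕ→ℚ ψ) ⟩
    ℕ→ℚ ψ - ε * ℕ→ℚ ψ                     ≤⟨ +-monoˡ-≤ (ℚ.- (ε * ℕ→ℚ ψ)) ψ≤γ+εψ ⟩
    ℕ→ℚ γ + ε * ℕ→ℚ ψ - ε * ℕ→ℚ ψ         ≡⟨ cancel (ℕ→ℚ γ) (ε * ℕ→ℚ ψ) ⟩
    ℕ→ℚ γ                                 ∎
    where
    open ≤-Reasoning
    open +-*-Solver
    distribute : ∀ e p → (1ℚ - e) * p ≡ p - e * p
    distribute = solve 2 (λ e p → (con 1ℚ :- e) :* p := p :- e :* p) refl
    cancel : ∀ g x → g + x - x ≡ g
    cancel = solve 2 (λ g x → g :+ x :- x := g) refl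
    b≤εψ : ℕ→ℚ b ≤ ε * ℕ→ℚ ψ
    b≤εψ = begin
      ℕ→ℚ b                      ≡⟨ *-identityˡ (ℕ→ℚ b) ⟨
      1ℚ * ℕ→ℚ b                 ≤⟨ *-monoʳ-≤-nonNeg (ℕ→ℚ b) {{nonNegative (ℕ→ℚ-mono-≤ {0} {b} ℕ.z≤n)}} 1≤εk ⟩
      ε * ℕ→ℚ k * ℕ→ℚ b          ≡⟨ ≡-trans (*-assoc ε (ℕ→ℚ k) (ℕ→ℚ b)) (cong (ε *_) (≡-sym (ℕ→ℚ-* k b))) ⟩
      ε * ℕ→ℚ (k ℕ.* b)          ≤⟨ *-monoˡ-≤-nonNeg ε {{nonNegative 0≤ε}} (ℕ→ℚ-mono-≤ kb≤ψ) ⟩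
      ε * ℕ→ℚ ψ                  ∎
    ψ≤γ+εψ : ℕ→ℚ ψ ≤ ℕ→ℚ γ + ε * ℕ→ℚ ψ
    ψ≤γ+εψ = ≤-trans (ℕ→ℚ-mono-≤ ψ≤γ+b) (≤-trans (≤-reflexive (ℕ→ℚ-+ γ b)) (+-monoʳ-≤ (ℕ→ℚ γ) b≤εψ))

  10≤ε²L : ∀ ε k L → 0ℚ ≤ ε → 1ℚ ≤ ε * ℕ→ℚ k → 10 ℕ.* (k ℕ.* k) ℕ.≤ L → ℕ→ℚ 10 ≤ ε * ε * ℕ→ℚ L
  10≤ε²L ε k L 0≤ε 1≤εk 10k²≤L = begin
    + 10 / 1                                    ≡⟨ *-identityʳ (+ 10 / 1) ⟨
    + 10 / 1 * 1ℚ                               ≤⟨ *-monoˡ-≤-nonNeg (+ 10 / 1) {{_}} 1≤[εk]² ⟩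
    + 10 / 1 * ((ε * ℕ→ℚ k) * (ε * ℕ→ℚ k))      ≡⟨ regroup ε (ℕ→ℚ k) ⟩
    ε * ε * (+ 10 / 1 * (ℕ→ℚ k * ℕ→ℚ k))
      ≡⟨ cong (ε * ε *_) (≡-trans (ℕ→ℚ-* 10 (k ℕ.* k)) (cong (+ 10 / 1 *_) (ℕ→ℚ-* k k))) ⟨
    ε * ε * ℕ→ℚ (10 ℕ.* (k ℕ.* k))
      ≤⟨ *-monoˡ-≤-nonNeg (ε * ε) {{nonNegative (0≤p*q 0≤ε 0≤ε)}} (ℕ→ℚ-mono-≤ 10k²≤L) ⟩
    ε * ε * ℕ→ℚ L                               ∎
    where
    open ≤-Reasoning
    open +-*-Solver
    0≤εk : 0ℚ ≤ ε * ℕ→ℚ k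
    0≤εk = ≤-trans (nonNegative⁻¹ 1ℚ) 1≤εk
    1≤[εk]² : 1ℚ ≤ (ε * ℕ→ℚ k) * (ε * ℕ→ℚ k)
    1≤[εk]² = ≤-trans 1≤εk (≤-trans (≤-reflexive (≡-sym (*-identityʳ _))) (*-monoˡ-≤-nonNeg (ε * ℕ→ℚ k) {{nonNegative 0≤εk}} 1≤εk))
    regroup : ∀ e c → + 10 / 1 * ((e * c) * (e * c)) ≡ e * e * (+ 10 / 1 * (c * c))
    regroup = solve 2 (λ e c → con (+ 10 / 1) :* ((e :* c) :* (e :* c)) := e :* e :* (con (+ 10 / 1) :* (c :* c))) refl

open Rational

open import Data.Nat as ℕ
  using (ℕ; zero; suc; _+_; _*_; _^_; _∸_; _≤_; _<_; z≤n; s≤s; s≤s⁻¹; z<s; ∣_-_∣; NonZero; >-nonZero; _≟_; _≤?_; _<?_)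
open import Data.Nat.Properties
open import Data.Nat.Divisibility using (_∣_; _∣?_; ∣m+n∣m⇒∣n; ∣m∣n⇒∣m+n; ∣⇒≤; ∣-trans; _∣0; 0∣⇒≡0)
open import Data.Nat.GCD using (gcd[m,n]∣m; gcd[m,n]∣n)
open import Data.Nat.Tactic.RingSolver using (solve-∀)
open import Data.Vec.Relation.Unary.All using (All; []; _∷_; all?)
import Data.Vec.Relation.Unary.All as AllV
open import Data.List.Properties using (upTo-∷ʳ; length-upTo)
open import Data.List.Membership.Propositional using (_∈_; find; lose)
open import Data.List.Membership.Propositional.Properties using (∈-map⁻; ∈-concatMap⁻; ∈-upTo⁻; ∈-filter⁺)
open import Data.List.Relation.Unary.Any using (here; there)
open import Data.Bool using (true; false)
open import Relation.Nullary using (Dec; yes; no; ¬_; _because_; ¬?)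
open import Relation.Unary using (Pred; Decidable)
open import Relation.Binary.PropositionalEquality
import Data.Integer.Properties as ℤP
open import Data.Rational as ℚ using (ℚ; 0ℚ; 1ℚ; _-_) renaming (_≤_ to _≤ℚ_; _<_ to _<ℚ_; _*_ to _*ℚ_)
import Data.Rational.Properties as ℚP

open ListSum +-*-commutativeSemiring
module ℤ∑ = ListSum ℤP.+-*-commutativeSemiring

private variable
  A : Set
  P : Pred A 0ℓ

∑-const : ∀ (xs : List A) k → ∑[ x ∈ xs ] k ≡ length xs * k
∑-const []       k = refl
∑-const (x ∷ xs) k = cong (k +_) (∑-const xs k)

∑-mono-≤ : ∀ xs {f g : A → ℕ} → (∀ x → x ∈ xs → f x ≤ g x) → ∑ xs f ≤ ∑ xs g
∑-mono-≤ []       f≤g = z≤n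
∑-mono-≤ (x ∷ xs) f≤g = +-mono-≤ (f≤g x (here refl)) (∑-mono-≤ xs (λ y y∈ → f≤g y (there y∈)))

length≤∑ : ∀ xs {f : A → ℕ} → (∀ x → x ∈ xs → 1 ≤ f x) → length xs ≤ ∑ xs f
length≤∑ xs 1≤f = ≤-trans (≤-reflexive (trans (sym (*-identityʳ _)) (sym (∑-const xs 1)))) (∑-mono-≤ xs 1≤f)

∈⇒≤∑ : ∀ (f : A → ℕ) {x xs} → x ∈ xs → f x ≤ ∑ xs f
∈⇒≤∑ f {xs = y ∷ xs} (here refl) = m≤m+n (f y) (∑ xs f)
∈⇒≤∑ f {xs = y ∷ xs} (there x∈) = ≤-trans (∈⇒≤∑ f x∈) (m≤n+m (∑ xs f) (f y))

∑-filter-≤ : ∀ (P? : Decidable P) xs (f : A → ℕ) → ∑ (filter P? xs) f ≤ ∑ xs f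
∑-filter-≤ P? []       f = z≤n
∑-filter-≤ P? (x ∷ xs) f with P? x
... | yes _ = +-monoʳ-≤ (f x) (∑-filter-≤ P? xs f)
... | no  _ = ≤-trans (∑-filter-≤ P? xs f) (m≤n+m _ (f x))

𝟙 : {B : Set} → Dec B → ℕ
𝟙 (true  because _) = 1
𝟙 (false because _) = 0

𝟙-yes : {B : Set} (b? : Dec B) → B → 𝟙 b? ≡ 1
𝟙-yes (yes _) _ = refl
𝟙-yes (no ¬b) b = ⊥-elim (¬b b)

𝟙-no : {B : Set} (b? : Dec B) → ¬ B → 𝟙 b? ≡ 0
𝟙-no (yes b) ¬b = ⊥-elim (¬b b)
𝟙-no (no _)  _  = refl

length-filter≡∑𝟙 : ∀ (P? : Decidable P) xs → length (filter P? xs) ≡ ∑[ x ∈ xs ] 𝟙 (P? x)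
length-filter≡∑𝟙 P? []       = refl
length-filter≡∑𝟙 P? (x ∷ xs) with P? x
... | yes _ = cong suc (length-filter≡∑𝟙 P? xs)
... | no  _ = length-filter≡∑𝟙 P? xs

markov : ∀ (P? : Decidable P) T (f : A → ℕ) xs → (∀ x → P x → T ≤ f x) →
  T * length (filter P? xs) ≤ ∑ xs f
markov P? T f xs T≤f = begin
  T * length (filter P? xs)     ≡⟨ cong (T *_) (length-filter≡∑𝟙 P? xs) ⟩
  T * ∑[ x ∈ xs ] 𝟙 (P? x)      ≡⟨ ∑-distribˡ xs T (𝟙 ∘ P?) ⟨
  ∑[ x ∈ xs ] (T * 𝟙 (P? x))    ≤⟨ ∑-mono-≤ xs (λ x _ → T*𝟙≤f x) ⟩
  ∑ xs f                        ∎
  where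
  open ≤-Reasoning
  T*𝟙≤f : ∀ x → T * 𝟙 (P? x) ≤ f x
  T*𝟙≤f x with P? x
  ... | yes Px = ≤-trans (≤-reflexive (*-identityʳ T)) (T≤f x Px)
  ... | no  _  = ≤-trans (≤-reflexive (*-zeroʳ T)) z≤n

∑-upTo-suc : ∀ n (f : ℕ → ℕ) → ∑ (upTo (suc n)) f ≡ ∑ (upTo n) f + f n
∑-upTo-suc n f = begin
  ∑ (upTo (suc n)) f           ≡⟨ cong (λ xs → ∑ xs f) (upTo-∷ʳ n) ⟨
  ∑ (upTo n ∷ʳ n) f            ≡⟨ ∑-++ (upTo n) (n ∷ []) f ⟩
  ∑ (upTo n) f + (f n + 0)     ≡⟨ cong (∑ (upTo n) f +_) (+-identityʳ (f n)) ⟩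
  ∑ (upTo n) f + f n           ∎
  where open ≡-Reasoning

-- Residue classes of grid points

module _ {P : Pred ℕ 0ℓ} (P? : Decidable P) (g : ℕ)
         (separated : ∀ {x x′} → P x → P x′ → x < x′ → x + g ≤ x′) where

  private
    hits : ℕ → ℕ
    hits n = ∑[ x ∈ upTo n ] 𝟙 (P? x)

    LastHit : ℕ → Set
    LastHit n = hits n ≡ 0 ⊎ ∃[ h ] (h < n × P h × g * hits n ≤ h + g)

    lastHit : ∀ n → LastHit n
    lastHit zero = inj₁ refl
    lastHit (suc n) with P? n | lastHit n
    ... | no ¬Pn | last = carry last
      where
      same : hits (suc n) ≡ hits n
      same = trans (∑-upTo-suc n (𝟙 ∘ P?)) (trans (cong (hits n +_) (𝟙-no (P? n) ¬Pn)) (+-identityʳ _))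
      carry : LastHit n → LastHit (suc n)
      carry (inj₁ none) = inj₁ (trans same none)
      carry (inj₂ (h , h<n , Ph , bound)) = inj₂ (h , m≤n⇒m≤1+n h<n , Ph , subst (λ c → g * c ≤ h + g) (sym same) bound)
    ... | yes Pn | last = inj₂ (n , ≤-refl , Pn , newBound last)
      where
      one-more : hits (suc n) ≡ hits n + 1
      one-more = trans (∑-upTo-suc n (𝟙 ∘ P?)) (cong (hits n +_) (𝟙-yes (P? n) Pn))
      newBound : LastHit n → g * hits (suc n) ≤ n + g
      newBound (inj₁ none) = begin
        g * hits (suc n)   ≡⟨ cong (g *_) (trans one-more (cong (_+ 1) none)) ⟩
        g * 1              ≡⟨ *-identityʳ g ⟩
        g                  ≤⟨ m≤n+m g n ⟩
        n + g              ∎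
        where open ≤-Reasoning
      newBound (inj₂ (h , h<n , Ph , bound)) = begin
        g * hits (suc n)   ≡⟨ cong (g *_) one-more ⟩
        g * (hits n + 1)   ≡⟨ trans (*-distribˡ-+ g (hits n) 1) (cong (g * hits n +_) (*-identityʳ g)) ⟩
        g * hits n + g     ≤⟨ +-monoˡ-≤ g (≤-trans bound (separated Ph Pn h<n)) ⟩
        n + g              ∎
        where open ≤-Reasoning

  separated-count : ∀ N → g * ∑[ x ∈ upTo (suc N) ] 𝟙 (P? x) ≤ N + g
  separated-count N with lastHit (suc N)
  ... | inj₁ none = ≤-trans (≤-reflexive (trans (cong (g *_) none) (*-zeroʳ g))) z≤n
  ... | inj₂ (h , h<1+N , _ , bound) = ≤-trans bound (+-monoˡ-≤ g (s≤s⁻¹ h<1+N))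

𝟙-all? : ∀ {P : Pred ℕ 0ℓ} (P? : Decidable P) x {d} (xs : Vec ℕ d) →
  𝟙 (all? P? (x ∷ xs)) ≡ 𝟙 (P? x) * 𝟙 (all? P? xs)
𝟙-all? P? x xs with P? x | all? P? xs
... | yes _ | yes _ = refl
... | yes _ | no  _ = refl
... | no  _ | _     = refl

∣-∣-between : ∀ {x y z} → x ≤ y → y ≤ z → ∣ x - z ∣ ≡ ∣ x - y ∣ + ∣ y - z ∣
∣-∣-between {zero} {y} z≤n y≤z = trans (sym (m+[n∸m]≡n y≤z)) (cong (y +_) (sym (m≤n⇒∣m-n∣≡n∸m y≤z)))
∣-∣-between (s≤s x≤y) (s≤s y≤z) = ∣-∣-between x≤y y≤z

∣-∣-congruence : ∀ {g y x x′} → x ≤ x′ → g ∣ ∣ x - y ∣ → g ∣ ∣ x′ - y ∣ → g ∣ ∣ x - x′ ∣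
∣-∣-congruence {g} {y} {x} {x′} x≤x′ g∣x-y g∣x′-y with ≤-total y x | ≤-total y x′
... | inj₁ y≤x | _ = ∣m+n∣m⇒∣n
  (subst (g ∣_) (trans (∣-∣-comm x′ y) (∣-∣-between y≤x x≤x′)) g∣x′-y)
  (subst (g ∣_) (∣-∣-comm x y) g∣x-y)
... | inj₂ x≤y | inj₁ y≤x′ = subst (g ∣_) (sym (∣-∣-between x≤y y≤x′))
  (∣m∣n⇒∣m+n g∣x-y (subst (g ∣_) (∣-∣-comm x′ y) g∣x′-y))
... | inj₂ x≤y | inj₂ x′≤y = ∣m+n∣m⇒∣n
  (subst (g ∣_) (trans (∣-∣-between x≤x′ x′≤y) (+-comm ∣ x - x′ ∣ ∣ x′ - y ∣)) g∣x-y)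
  g∣x′-y

congruent-separated : ∀ g .{{_ : NonZero g}} y {x x′} →
  g ∣ ∣ x - y ∣ → g ∣ ∣ x′ - y ∣ → x < x′ → x + g ≤ x′
congruent-separated g y {x} {x′} g∣x-y g∣x′-y x<x′ = begin
  x + g              ≤⟨ +-monoʳ-≤ x (∣⇒≤ {{>-nonZero (m<n⇒0<n∸m x<x′)}} g∣x′∸x) ⟩
  x + (x′ ∸ x)       ≡⟨ m+[n∸m]≡n (<⇒≤ x<x′) ⟩
  x′                 ∎
  where
  open ≤-Reasoning
  g∣x′∸x : g ∣ x′ ∸ x
  g∣x′∸x = subst (g ∣_) (m≤n⇒∣m-n∣≡n∸m (<⇒≤ x<x′)) (∣-∣-congruence (<⇒≤ x<x′) g∣x-y g∣x′-y)

Congruent : ℕ → ∀ {d} → Pt d → Pt d → Set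
Congruent g p y = All (g ∣_) (zipWith ∣_-_∣ p y)

congruent? : ∀ g {d} (p y : Pt d) → Dec (Congruent g p y)
congruent? g p y = all? (g ∣?_) (zipWith ∣_-_∣ p y)

count-congruent : ∀ d N g .{{_ : NonZero g}} (y : Pt d) →
  g ^ d * ∑[ p ∈ grid d N ] 𝟙 (congruent? g p y) ≤ (N + g) ^ d
count-congruent zero    N g [] = ≤-refl
count-congruent (suc d) N g (y₀ ∷ y) = begin
  g ^ suc d * ∑[ p ∈ grid (suc d) N ] 𝟙 (congruent? g p (y₀ ∷ y))
    ≡⟨ cong (g ^ suc d *_) (trans (∑-grid d N _) (∑-cong U λ x →
         trans (∑-cong (grid d N) λ p → 𝟙-all? (g ∣?_) ∣ x - y₀ ∣ (zipWith ∣_-_∣ p y))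
               (∑-distribˡ (grid d N) (𝟙 (g ∣? ∣ x - y₀ ∣)) (λ p → 𝟙 (congruent? g p y))))) ⟩
  g ^ suc d * ∑[ x ∈ U ] (𝟙 (g ∣? ∣ x - y₀ ∣) * hits)
    ≡⟨ cong (g ^ suc d *_) (trans (∑-cong U (λ x → *-comm (𝟙 (g ∣? ∣ x - y₀ ∣)) hits))
                                  (∑-distribˡ U hits (λ x → 𝟙 (g ∣? ∣ x - y₀ ∣)))) ⟩
  (g * g ^ d) * (hits * ∑[ x ∈ U ] 𝟙 (g ∣? ∣ x - y₀ ∣))
    ≡⟨ regroup g (g ^ d) hits (∑[ x ∈ U ] 𝟙 (g ∣? ∣ x - y₀ ∣)) ⟩
  (g * ∑[ x ∈ U ] 𝟙 (g ∣? ∣ x - y₀ ∣)) * (g ^ d * hits)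
    ≤⟨ *-mono-≤ (separated-count (λ x → g ∣? ∣ x - y₀ ∣) g (congruent-separated g y₀) N)
                (count-congruent d N g y) ⟩
  (N + g) * (N + g) ^ d ∎
  where
  open ≤-Reasoning
  U = upTo (suc N)
  hits = ∑[ p ∈ grid d N ] 𝟙 (congruent? g p y)
  regroup : ∀ a b c e → (a * b) * (c * e) ≡ (a * e) * (b * c)
  regroup = solve-∀

-- Summing over the moduli 2, …, N + 1

∈-iterate-suc⁻ : ∀ {g} a n → g ∈ iterate suc a n → a ≤ g × g < a + n
∈-iterate-suc⁻ a (suc n) (here refl) = ≤-refl , m<m+n a z<s
∈-iterate-suc⁻ {g} a (suc n) (there g∈) with ∈-iterate-suc⁻ (suc a) n g∈
... | a<g , g<1+a+n = <⇒≤ a<g , subst (g <_) (sym (+-suc a n)) g<1+a+n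

∈-iterate-suc⁺ : ∀ {g} a n → a ≤ g → g < a + n → g ∈ iterate suc a n
∈-iterate-suc⁺ a zero    a≤g g<a+0 = ⊥-elim (<-irrefl refl (≤-trans g<a+0 (≤-trans (≤-reflexive (+-identityʳ a)) a≤g)))
∈-iterate-suc⁺ {g} a (suc n) a≤g g<a+1+n with a ≟ g
... | yes refl = here refl
... | no  a≢g  = there (∈-iterate-suc⁺ (suc a) n (≤∧≢⇒< a≤g a≢g) (subst (g <_) (+-suc a n) g<a+1+n))

^-distrib-* : ∀ a b n → (a * b) ^ n ≡ a ^ n * b ^ n
^-distrib-* a b zero    = refl
^-distrib-* a b (suc n) = trans (cong (a * b *_) (^-distrib-* a b n)) (regroup a b (a ^ n) (b ^ n))
  where
  regroup : ∀ a b x y → a * b * (x * y) ≡ a * x * (b * y)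
  regroup = solve-∀

^-dominates : ∀ c a b {k j} → c * a ^ k ≤ b ^ k → a ≤ b → k ≤ j → c * a ^ j ≤ b ^ j
^-dominates c a b {k} base a≤b k≤j with i , refl ← m≤n⇒∃[o]m+o≡n k≤j = from-base i
  where
  open ≤-Reasoning
  x*[y*z]≡y*[x*z] : ∀ x y z → x * (y * z) ≡ y * (x * z)
  x*[y*z]≡y*[x*z] = solve-∀
  from-base : ∀ i → c * a ^ (k + i) ≤ b ^ (k + i)
  from-base zero    = subst (λ j → c * a ^ j ≤ b ^ j) (sym (+-identityʳ k)) base
  from-base (suc i) = begin
    c * a ^ (k + suc i)      ≡⟨ cong (λ j → c * a ^ j) (+-suc k i) ⟩
    c * (a * a ^ (k + i))    ≡⟨ x*[y*z]≡y*[x*z] c a (a ^ (k + i)) ⟩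
    a * (c * a ^ (k + i))    ≤⟨ *-mono-≤ a≤b (from-base i) ⟩
    b * b ^ (k + i)          ≡⟨ cong (b ^_) (+-suc k i) ⟨
    b ^ (k + suc i)          ∎

-- Σ_{g = c+1}^{c+n} 1/(g(g − 1)) = n/(c(c + n)).
telescope : ∀ (b : ℕ → ℕ) Q c n → (∀ g → g ∈ iterate suc (suc c) n → b g * (g * (g ∸ 1)) ≤ Q) →
  c * (c + n) * ∑ (iterate suc (suc c) n) b ≤ Q * n
telescope b Q c zero    _ = ≤-reflexive (trans (*-zeroʳ (c * (c + 0))) (sym (*-zeroʳ Q)))
telescope b Q c (suc n) bound = *-cancelˡ-≤ (suc c) (begin
  suc c * (c * (c + suc n) * (b (suc c) + rest))
    ≡⟨ split c n (b (suc c)) rest ⟩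
  b (suc c) * (suc c * c) * (suc c + n) + c * (suc c * (suc c + n) * rest)
    ≤⟨ +-mono-≤ (*-monoˡ-≤ (suc c + n) (bound (suc c) (here refl)))
                (*-monoʳ-≤ c (telescope b Q (suc c) n (λ g g∈ → bound g (there g∈)))) ⟩
  Q * (suc c + n) + c * (Q * n)
    ≡⟨ merge c n Q ⟩
  suc c * (Q * suc n) ∎)
  where
  open ≤-Reasoning
  rest = ∑ (iterate suc (suc (suc c)) n) b
  split : ∀ c n x s → (1 + c) * (c * (c + (1 + n)) * (x + s))
                    ≡ x * ((1 + c) * c) * (1 + c + n) + c * ((1 + c) * (1 + c + n) * s)
  split = solve-∀
  merge : ∀ c n q → q * (1 + c + n) + c * (q * n) ≡ (1 + c) * (q * (1 + n))
  merge = solve-∀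

-- A residue class modulo g has density at most ((N + g)/(g(N + 1)))^d in 𝒲.  This is at most
-- (3/5)^d for g ≤ 4 (using N ≥ 4) and at most (2/g)^d ≤ 2^d/(5^(d−2) g(g − 1)) for g ≥ 5, where
-- the sum over g telescopes.
small-modulus : ∀ {N g d t} → 4 ≤ N → 2 ≤ g → g ^ d * t ≤ (N + g) ^ d → 5 ^ d * t ≤ 3 ^ d * suc N ^ d
small-modulus {N} {g} {d} {t} 4≤N 2≤g bound = *-cancelˡ-≤ (g ^ d) {{gᵈ≢0}} (begin
  g ^ d * (5 ^ d * t)            ≡⟨ x*[y*z]≡y*[x*z] (g ^ d) (5 ^ d) t ⟩
  5 ^ d * (g ^ d * t)            ≤⟨ *-monoʳ-≤ (5 ^ d) bound ⟩
  5 ^ d * (N + g) ^ d            ≡⟨ ^-distrib-* 5 (N + g) d ⟨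
  (5 * (N + g)) ^ d              ≤⟨ ^-monoˡ-≤ d 5[N+g]≤3g[1+N] ⟩
  (g * (3 * suc N)) ^ d          ≡⟨ ^-distrib-* g (3 * suc N) d ⟩
  g ^ d * (3 * suc N) ^ d        ≡⟨ cong (g ^ d *_) (^-distrib-* 3 (suc N) d) ⟩
  g ^ d * (3 ^ d * suc N ^ d)    ∎)
  where
  open ≤-Reasoning
  gᵈ≢0 : NonZero (g ^ d)
  gᵈ≢0 = >-nonZero (m^n>0 g {{>-nonZero (≤-trans z<s 2≤g)}} d)
  x*[y*z]≡y*[x*z] : ∀ x y z → x * (y * z) ≡ y * (x * z)
  x*[y*z]≡y*[x*z] = solve-∀
  slack : ∀ n h → 5 * ((4 + n) + (2 + h)) + (n + 10 * h + 3 * h * n) ≡ (2 + h) * (3 * (5 + n))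
  slack = solve-∀
  5[N+g]≤3g[1+N] : 5 * (N + g) ≤ g * (3 * suc N)
  5[N+g]≤3g[1+N] with n , refl ← m≤n⇒∃[o]m+o≡n 4≤N | h , refl ← m≤n⇒∃[o]m+o≡n 2≤g =
    ≤-trans (m≤m+n _ _) (≤-reflexive (slack n h))

large-modulus : ∀ {N g d t} → 2 ≤ d → 5 ≤ g → g ≤ suc N → g ^ d * t ≤ (N + g) ^ d →
  t * 5 ^ (d ∸ 2) * (g * (g ∸ 1)) ≤ 2 ^ d * suc N ^ d
large-modulus {N} {g} {d} {t} 2≤d 5≤g g≤1+N bound with e , refl ← m≤n⇒∃[o]m+o≡n 2≤d = begin
  t * 5 ^ e * (g * (g ∸ 1))      ≤⟨ *-mono-≤ (*-monoʳ-≤ t (^-monoˡ-≤ e 5≤g)) (*-monoʳ-≤ g (m∸n≤m g 1)) ⟩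
  t * g ^ e * (g * g)            ≡⟨ regroup t (g ^ e) g ⟩
  g ^ (2 + e) * t                ≤⟨ bound ⟩
  (N + g) ^ (2 + e)              ≤⟨ ^-monoˡ-≤ (2 + e) N+g≤2[1+N] ⟩
  (2 * suc N) ^ (2 + e)          ≡⟨ ^-distrib-* 2 (suc N) (2 + e) ⟩
  2 ^ (2 + e) * suc N ^ (2 + e)  ∎
  where
  open ≤-Reasoning
  regroup : ∀ t x g → t * x * (g * g) ≡ g * (g * x) * t
  regroup = solve-∀
  N+g≤2[1+N] : N + g ≤ 2 * suc N
  N+g≤2[1+N] = ≤-trans (+-mono-≤ (n≤1+n N) g≤1+N) (≤-reflexive (cong (suc N +_) (sym (+-identityʳ (suc N)))))

small-moduli : ∀ {N d} → 4 ≤ N → 8 ≤ d → (T : ℕ → ℕ) → (∀ g → 2 ≤ g → g ≤ 4 → g ^ d * T g ≤ (N + g) ^ d) →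
  12 * (T 2 + T 3 + T 4) ≤ suc N ^ d
small-moduli {N} {d} 4≤N 8≤d T bound = *-cancelʳ-≤ _ _ (5 ^ d) {{>-nonZero (m^n>0 5 d)}} (begin
  12 * (T 2 + T 3 + T 4) * 5 ^ d                   ≡⟨ spread (T 2) (T 3) (T 4) (5 ^ d) ⟩
  12 * (5 ^ d * T 2 + 5 ^ d * T 3 + 5 ^ d * T 4)   ≤⟨ *-monoʳ-≤ 12 (+-mono-≤ (+-mono-≤ (small 2 (≤ᵇ⇒≤ 2 2 _) (≤ᵇ⇒≤ 2 4 _))
                                                                                 (small 3 (≤ᵇ⇒≤ 2 3 _) (≤ᵇ⇒≤ 3 4 _)))
                                                                       (small 4 (≤ᵇ⇒≤ 2 4 _) (≤ᵇ⇒≤ 4 4 _))) ⟩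
  12 * (3 ^ d * M + 3 ^ d * M + 3 ^ d * M)         ≡⟨ collect (3 ^ d) M ⟩
  36 * 3 ^ d * M                                   ≤⟨ *-monoˡ-≤ M 36*3ᵈ≤5ᵈ ⟩
  5 ^ d * M                                        ≡⟨ *-comm (5 ^ d) M ⟩
  M * 5 ^ d                                        ∎)
  where
  open ≤-Reasoning
  M = suc N ^ d
  small : ∀ g → 2 ≤ g → g ≤ 4 → 5 ^ d * T g ≤ 3 ^ d * M
  small g 2≤g g≤4 = small-modulus {d = d} 4≤N 2≤g (bound g 2≤g g≤4)
  36*3ᵈ≤5ᵈ : 36 * 3 ^ d ≤ 5 ^ d
  36*3ᵈ≤5ᵈ = ^-dominates 36 3 5 (≤ᵇ⇒≤ (36 * 3 ^ 8) (5 ^ 8) _) (≤ᵇ⇒≤ 3 5 _) 8≤d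
  spread : ∀ a b c f → 12 * (a + b + c) * f ≡ 12 * (f * a + f * b + f * c)
  spread = solve-∀
  collect : ∀ t m → 12 * (t * m + t * m + t * m) ≡ 36 * t * m
  collect = solve-∀

large-moduli : ∀ {d} n → 8 ≤ d → (T : ℕ → ℕ) → (∀ g → g ∈ iterate suc 5 n → g ^ d * T g ≤ (3 + n + g) ^ d) →
  12 * ∑ (iterate suc 5 n) T ≤ (4 + n) ^ d
large-moduli {d} n 8≤d T bound = *-cancelʳ-≤ _ _ (4 * 5 ^ e) {{>-nonZero (*-monoʳ-< 4 (m^n>0 5 e))}} (begin
  12 * Σ′ * (4 * 5 ^ e)          ≡⟨ reorder Σ′ (5 ^ e) ⟩
  12 * (4 * (5 ^ e * Σ′))        ≤⟨ *-monoʳ-≤ 12 telescoped ⟩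
  12 * (2 ^ d * M)               ≡⟨ cong (λ x → 12 * (x * M)) 2ᵈ≡4*2ᵉ ⟩
  12 * (4 * 2 ^ e * M)           ≡⟨ expand (2 ^ e) M ⟩
  4 * (12 * 2 ^ e) * M           ≤⟨ *-monoˡ-≤ M (*-monoʳ-≤ 4 12*2ᵉ≤5ᵉ) ⟩
  4 * 5 ^ e * M                  ≡⟨ *-comm (4 * 5 ^ e) M ⟩
  M * (4 * 5 ^ e)                ∎)
  where
  open ≤-Reasoning
  M = (4 + n) ^ d
  Σ′ = ∑ (iterate suc 5 n) T
  e = d ∸ 2
  2≤d : 2 ≤ d
  2≤d = ≤-trans (s≤s (s≤s z≤n)) 8≤d
  2ᵈ≡4*2ᵉ : 2 ^ d ≡ 4 * 2 ^ e
  2ᵈ≡4*2ᵉ = trans (cong (2 ^_) (sym (m+[n∸m]≡n 2≤d))) (^-distribˡ-+-* 2 2 e)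
  12*2ᵉ≤5ᵉ : 12 * 2 ^ e ≤ 5 ^ e
  12*2ᵉ≤5ᵉ = ^-dominates 12 2 5 (≤ᵇ⇒≤ (12 * 2 ^ 6) (5 ^ 6) _) (≤ᵇ⇒≤ 2 5 _) (∸-monoˡ-≤ 2 8≤d)
  large : ∀ g → g ∈ iterate suc 5 n → T g * 5 ^ e * (g * (g ∸ 1)) ≤ 2 ^ d * M
  large g g∈ with 5≤g , g<5+n ← ∈-iterate-suc⁻ 5 n g∈ = large-modulus 2≤d 5≤g (s≤s⁻¹ g<5+n) (bound g g∈)
  telescoped : 4 * (5 ^ e * Σ′) ≤ 2 ^ d * M
  telescoped = *-cancelʳ-≤ _ _ (4 + n) (begin
    4 * (5 ^ e * Σ′) * (4 + n)                              ≡⟨ reorder′ (5 ^ e * Σ′) (4 + n) ⟩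
    4 * (4 + n) * (5 ^ e * Σ′)                              ≡⟨ cong (4 * (4 + n) *_) ∑T5ᵉ≡5ᵉΣ′ ⟨
    4 * (4 + n) * ∑ (iterate suc 5 n) (λ g → T g * 5 ^ e)   ≤⟨ telescope (λ g → T g * 5 ^ e) (2 ^ d * M) 4 n large ⟩
    2 ^ d * M * n                                           ≤⟨ *-monoʳ-≤ (2 ^ d * M) (m≤n+m n 4) ⟩
    2 ^ d * M * (4 + n)                                     ∎)
    where
    ∑T5ᵉ≡5ᵉΣ′ : ∑ (iterate suc 5 n) (λ g → T g * 5 ^ e) ≡ 5 ^ e * Σ′
    ∑T5ᵉ≡5ᵉΣ′ = trans (∑-cong (iterate suc 5 n) (λ g → *-comm (T g) (5 ^ e))) (∑-distribˡ (iterate suc 5 n) (5 ^ e) T)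
    reorder′ : ∀ s k → 4 * s * k ≡ 4 * k * s
    reorder′ = solve-∀
  reorder : ∀ s f → 12 * s * (4 * f) ≡ 12 * (4 * (f * s))
  reorder = solve-∀
  expand : ∀ t m → 12 * (4 * t * m) ≡ 4 * (12 * t) * m
  expand = solve-∀

modulus-sum-bound : ∀ {N d} → 4 ≤ N → 8 ≤ d → (T : ℕ → ℕ) →
  (∀ g → g ∈ iterate suc 2 N → g ^ d * T g ≤ (N + g) ^ d) →
  6 * ∑ (iterate suc 2 N) T ≤ suc N ^ d
modulus-sum-bound {N} {d} 4≤N 8≤d T bound with n , refl ← m≤n⇒∃[o]m+o≡n 4≤N = *-cancelˡ-≤ 2 (begin
  2 * (6 * (T 2 + (T 3 + (T 4 + Σ′))))   ≡⟨ distribute (T 2) (T 3) (T 4) Σ′ ⟩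
  12 * (T 2 + T 3 + T 4) + 12 * Σ′       ≤⟨ +-mono-≤ (small-moduli 4≤N 8≤d T small) (large-moduli (suc n) 8≤d T large) ⟩
  M + M                                  ≡⟨ cong (M +_) (+-identityʳ M) ⟨
  2 * M                                  ∎)
  where
  open ≤-Reasoning
  M = suc N ^ d
  Σ′ = ∑ (iterate suc 5 (suc n)) T
  distribute : ∀ a b c s → 2 * (6 * (a + (b + (c + s)))) ≡ 12 * (a + b + c) + 12 * s
  distribute = solve-∀
  small : ∀ g → 2 ≤ g → g ≤ 4 → g ^ d * T g ≤ (N + g) ^ d
  small g 2≤g g≤4 = bound g (∈-iterate-suc⁺ 2 N 2≤g (s≤s (≤-trans g≤4 (≤-trans (m≤m+n 4 n) (n≤1+n N)))))
  large : ∀ g → g ∈ iterate suc 5 (suc n) → g ^ d * T g ≤ (N + g) ^ d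
  large g g∈ = bound g (there (there (there g∈)))

-- Visibility and a lower bound for |Ψ|

∈-grid⁻ : ∀ d N {p} → p ∈ grid d N → All (_≤ N) p
∈-grid⁻ zero    N {[]} _ = []
∈-grid⁻ (suc d) N p∈
  with x , x∈ , p∈′ ← find (∈-concatMap⁻ (λ x → map (x ∷_) (grid d N)) {xs = upTo (suc N)} p∈)
  with p′ , p′∈ , refl ← ∈-map⁻ (x ∷_) p∈′ = s≤s⁻¹ (∈-upTo⁻ x∈) ∷ ∈-grid⁻ d N p′∈

gcdVec-divides : ∀ {d} (v : Vec ℕ d) → All (gcdVec v ∣_) v
gcdVec-divides []      = []
gcdVec-divides (x ∷ v) = gcd[m,n]∣m x (gcdVec v) ∷ AllV.map (∣-trans (gcd[m,n]∣n x (gcdVec v))) (gcdVec-divides v)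

∣-∣-bounded : ∀ {N d} {p y : Pt d} → All (_≤ N) p → All (_≤ N) y → All (_≤ N) (zipWith ∣_-_∣ p y)
∣-∣-bounded []           []           = []
∣-∣-bounded {p = x ∷ _} {y ∷ _} (x≤N ∷ p≤N) (y≤N ∷ y≤N′) =
  ≤-trans (∣m-n∣≤m⊔n x y) (⊔-lub x≤N y≤N) ∷ ∣-∣-bounded p≤N y≤N′

overlarge-divisor-vanishes : ∀ {G N e} → G ∣ e → e ≤ N → G ≡ 0 ⊎ N < G → suc N ∣ e
overlarge-divisor-vanishes G∣e e≤N (inj₁ refl) = subst (suc _ ∣_) (sym (0∣⇒≡0 G∣e)) (suc _ ∣0)
overlarge-divisor-vanishes {e = zero}  G∣e e≤N (inj₂ N<G) = suc _ ∣0
overlarge-divisor-vanishes {e = suc e} G∣e e≤N (inj₂ N<G) =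
  ⊥-elim (<-irrefl refl (≤-trans N<G (≤-trans (∣⇒≤ G∣e) e≤N)))

-- The modulus is gcd(p − y) unless that is 0 or exceeds N; then p = y and N + 1 serves.
¬visible⇒congruent : ∀ {N d} {p y : Pt d} → 1 ≤ N → All (_≤ N) p → All (_≤ N) y → ¬ Visible p y →
  ∃[ g ] (g ∈ iterate suc 2 N × Congruent g p y)
¬visible⇒congruent {N} {d} {p} {y} 1≤N p≤N y≤N ¬vis = witness (gcdVec v) refl
  where
  v = zipWith ∣_-_∣ p y
  top : suc N ∈ iterate suc 2 N
  top = ∈-iterate-suc⁺ 2 N (s≤s 1≤N) ≤-refl
  vanish : ∀ {G} → All (G ∣_) v → G ≡ 0 ⊎ N < G → Congruent (suc N) p y
  vanish G∣v small-or-large =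
    AllV.map (λ (G∣e , e≤N) → overlarge-divisor-vanishes G∣e e≤N small-or-large) (AllV.zip (G∣v , ∣-∣-bounded p≤N y≤N))
  divides : ∀ {G} → gcdVec v ≡ G → All (G ∣_) v
  divides gcd≡G = subst (λ G → All (G ∣_) v) gcd≡G (gcdVec-divides v)
  witness : ∀ G → gcdVec v ≡ G → ∃[ g ] (g ∈ iterate suc 2 N × Congruent g p y)
  witness zero          gcd≡G = suc N , top , vanish (divides gcd≡G) (inj₁ refl)
  witness (suc zero)    gcd≡G = ⊥-elim (¬vis gcd≡G)
  witness (suc (suc k)) gcd≡G with suc (suc k) ≤? suc N
  ... | yes G≤1+N = suc (suc k) , ∈-iterate-suc⁺ 2 N (s≤s (s≤s z≤n)) (s≤s G≤1+N) , divides gcd≡G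
  ... | no  G≰1+N = suc N , top , vanish (divides gcd≡G) (inj₂ (≤-trans (n≤1+n _) (≰⇒> G≰1+N)))

invisible : ∀ {d} → Pt d → Pt d → ℕ
invisible p q = 𝟙 (¬? (visible? p q))

count-¬visible : ∀ {d N} (y : Pt d) → 4 ≤ N → 8 ≤ d → All (_≤ N) y →
  6 * ∑[ p ∈ grid d N ] invisible p y ≤ suc N ^ d
count-¬visible {d} {N} y 4≤N 8≤d y≤N = begin
  6 * ∑[ p ∈ grid d N ] invisible p y
    ≤⟨ *-monoʳ-≤ 6 (∑-mono-≤ (grid d N) (λ p p∈ → ¬visible≤∑ p (∈-grid⁻ d N p∈))) ⟩
  6 * ∑[ p ∈ grid d N ] ∑[ g ∈ moduli ] 𝟙 (congruent? g p y)
    ≡⟨ cong (6 *_) (∑-comm (grid d N) moduli (λ p g → 𝟙 (congruent? g p y))) ⟩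
  6 * ∑[ g ∈ moduli ] ∑[ p ∈ grid d N ] 𝟙 (congruent? g p y)
    ≤⟨ modulus-sum-bound 4≤N 8≤d _ count ⟩
  suc N ^ d ∎
  where
  open ≤-Reasoning
  moduli = iterate suc 2 N
  1≤N : 1 ≤ N
  1≤N = ≤-trans (s≤s z≤n) 4≤N
  ¬visible≤∑ : ∀ p → All (_≤ N) p → invisible p y ≤ ∑[ g ∈ moduli ] 𝟙 (congruent? g p y)
  ¬visible≤∑ p p≤N with visible? p y
  ... | yes _   = z≤n
  ... | no ¬vis with g , g∈ , p≡y ← ¬visible⇒congruent 1≤N p≤N y≤N ¬vis =
    ≤-trans (≤-reflexive (sym (𝟙-yes (congruent? g p y) p≡y))) (∈⇒≤∑ (λ g → 𝟙 (congruent? g p y)) g∈)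
  count : ∀ g → g ∈ moduli → g ^ d * ∑[ p ∈ grid d N ] 𝟙 (congruent? g p y) ≤ (N + g) ^ d
  count g g∈ with 2≤g , _ ← ∈-iterate-suc⁻ 2 N g∈ = count-congruent d N g {{>-nonZero (≤-trans z<s 2≤g)}} y

length≡∑1 : ∀ (xs : List A) → length xs ≡ ∑[ x ∈ xs ] 1
length≡∑1 xs = trans (sym (*-identityʳ (length xs))) (sym (∑-const xs 1))

length-grid : ∀ d N → length (grid d N) ≡ suc N ^ d
length-grid zero    N = refl
length-grid (suc d) N = begin
  length (grid (suc d) N)                 ≡⟨ length≡∑1 (grid (suc d) N) ⟩
  ∑[ p ∈ grid (suc d) N ] 1               ≡⟨ ∑-grid d N (λ _ → 1) ⟩
  ∑[ x ∈ upTo (suc N) ] ∑[ p ∈ grid d N ] 1 ≡⟨ ∑-cong (upTo (suc N)) (λ _ → sym (length≡∑1 (grid d N))) ⟩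
  ∑[ x ∈ upTo (suc N) ] length (grid d N)  ≡⟨ ∑-const (upTo (suc N)) _ ⟩
  length (upTo (suc N)) * length (grid d N) ≡⟨ cong₂ _*_ (length-upTo (suc N)) (length-grid d N) ⟩
  suc N * suc N ^ d                       ∎
  where open ≡-Reasoning

origin : ∀ {d} → Pt d
origin {d} = replicate d 0

zipWith-∣-∣-origin : ∀ {d} (p : Pt d) → zipWith ∣_-_∣ p origin ≡ p
zipWith-∣-∣-origin []      = refl
zipWith-∣-∣-origin (x ∷ p) = cong₂ _∷_ (∣-∣-identityʳ x) (zipWith-∣-∣-origin p)

visible-origin⇒primitive : ∀ {d} (p : Pt d) → Visible p origin → Primitive p
visible-origin⇒primitive p = subst (λ v → gcdVec v ≡ 1) (zipWith-∣-∣-origin p)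

onRay-self : ∀ {d} (p : Pt d) → Primitive p → OnRay p p
onRay-self p prim rewrite prim = sym (map-1* p) , s≤s z≤n
  where
  map-1* : ∀ {d} (p : Pt d) → Vec.map (1 *_) p ≡ p
  map-1* []      = refl
  map-1* (x ∷ p) = cong₂ _∷_ (+-identityʳ x) (map-1* p)

visible⇒InΨ : ∀ {d N} {p q : Pt d} → (p , q) ∈ cartesianProduct (grid d N) (grid d N) →
  Visible p origin → Visible q origin → Visible p q → InΨ N (p , q)
visible⇒InΨ {p = p} {q} pq∈ p-vis q-vis pq-vis =
  prim-p , prim-q , lose (∈-filter⁺ (λ vw → visible? (proj₁ vw) (proj₂ vw)) pq∈ pq-vis) (onRay-self p prim-p , onRay-self q prim-q)
  where
  prim-p : Primitive p
  prim-p = visible-origin⇒primitive p p-vis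
  prim-q : Primitive q
  prim-q = visible-origin⇒primitive q q-vis

length-cartesianProduct : ∀ {B : Set} (xs : List A) (ys : List B) →
  length (cartesianProduct xs ys) ≡ length xs * length ys
length-cartesianProduct xs ys = begin
  length (cartesianProduct xs ys)  ≡⟨ length≡∑1 (cartesianProduct xs ys) ⟩
  ∑ (cartesianProduct xs ys) (λ _ → 1) ≡⟨ ∑-cartesianProduct xs ys (λ _ → 1) ⟩
  ∑[ x ∈ xs ] ∑[ y ∈ ys ] 1         ≡⟨ ∑-cong xs (λ _ → sym (length≡∑1 ys)) ⟩
  ∑[ x ∈ xs ] length ys             ≡⟨ ∑-const xs (length ys) ⟩
  length xs * length ys             ∎
  where open ≡-Reasoning

rows-bound : ∀ {B : Set} (xs : List A) (ys : List B) (F : A → B → ℕ) k r →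
  (∀ x → x ∈ xs → k * ∑ ys (F x) ≤ r) → k * ∑[ x ∈ xs ] ∑[ y ∈ ys ] F x y ≤ length xs * r
rows-bound xs ys F k r row = begin
  k * ∑[ x ∈ xs ] ∑[ y ∈ ys ] F x y   ≡⟨ ∑-distribˡ xs k (λ x → ∑ ys (F x)) ⟨
  ∑[ x ∈ xs ] (k * ∑ ys (F x))        ≤⟨ ∑-mono-≤ xs row ⟩
  ∑[ x ∈ xs ] r                       ≡⟨ ∑-const xs r ⟩
  length xs * r                       ∎
  where open ≤-Reasoning

origin-bounded : ∀ {d N} → All (_≤ N) (origin {d})
origin-bounded {zero}  = []
origin-bounded {suc d} = z≤n ∷ origin-bounded

Ψ-or-invisible : ∀ {d N} {p q : Pt d} → (p , q) ∈ cartesianProduct (grid d N) (grid d N) →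
  1 ≤ 𝟙 (inΨ? N (p , q)) + (invisible p origin + invisible q origin + invisible p q)
Ψ-or-invisible {d} {N} {p} {q} pq∈ with visible? p origin | visible? q origin | visible? p q
... | no _      | _         | _          = ≤-trans (s≤s z≤n) (m≤n+m _ (𝟙 (inΨ? N (p , q))))
... | yes _     | no _      | _          = ≤-trans (s≤s z≤n) (m≤n+m _ (𝟙 (inΨ? N (p , q))))
... | yes _     | yes _     | no _       = ≤-trans (s≤s z≤n) (m≤n+m _ (𝟙 (inΨ? N (p , q))))
... | yes p-vis | yes q-vis | yes pq-vis =
  ≤-trans (≤-reflexive (sym (𝟙-yes (inΨ? N (p , q)) (visible⇒InΨ pq∈ p-vis q-vis pq-vis)))) (m≤m+n _ 0)

length-Ψ-large : ∀ {d N} → 4 ≤ N → 8 ≤ d → suc N ^ d * suc N ^ d ≤ 2 * length (Ψ d N)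
length-Ψ-large {d} {N} 4≤N 8≤d = *-cancelˡ-≤ 3 (+-cancelʳ-≤ (3 * (M * M)) _ _ (begin
  3 * (M * M) + 3 * (M * M)                       ≡⟨ six (M * M) ⟩
  6 * (M * M)                                     ≤⟨ *-monoʳ-≤ 6 covered ⟩
  6 * (ψ + (a + b + c))                           ≡⟨ spread ψ a b c ⟩
  3 * (2 * ψ) + (6 * a + 6 * b + 6 * c)           ≤⟨ +-monoʳ-≤ (3 * (2 * ψ)) (+-mono-≤ (+-mono-≤ 6a≤ 6b≤) 6c≤) ⟩
  3 * (2 * ψ) + (|G| * M + |G| * M + |G| * M)     ≡⟨ cong (λ n → 3 * (2 * ψ) + (n * M + n * M + n * M)) (length-grid d N) ⟩
  3 * (2 * ψ) + (M * M + M * M + M * M)           ≡⟨ cong (_+_ (3 * (2 * ψ))) (three (M * M)) ⟩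
  3 * (2 * ψ) + 3 * (M * M)                       ∎))
  where
  open ≤-Reasoning
  G = grid d N
  G² = cartesianProduct G G
  M = suc N ^ d
  |G| = length G
  ψ = length (Ψ d N)
  a = ∑[ p ∈ G ] ∑[ q ∈ G ] invisible p origin
  b = ∑[ p ∈ G ] ∑[ q ∈ G ] invisible q origin
  c = ∑[ p ∈ G ] ∑[ q ∈ G ] invisible p q
  blind : Pt d × Pt d → ℕ
  blind (p , q) = invisible p origin + invisible q origin + invisible p q
  six : ∀ x → 3 * x + 3 * x ≡ 6 * x
  six = solve-∀
  three : ∀ x → x + x + x ≡ 3 * x
  three = solve-∀
  spread : ∀ ψ a b c → 6 * (ψ + (a + b + c)) ≡ 3 * (2 * ψ) + (6 * a + 6 * b + 6 * c)
  spread = solve-∀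
  ∑blind≡ : ∑ G² blind ≡ a + b + c
  ∑blind≡ = begin-equality
    ∑ G² blind
      ≡⟨ ∑-cartesianProduct G G blind ⟩
    ∑[ p ∈ G ] ∑[ q ∈ G ] (invisible p origin + invisible q origin + invisible p q)
      ≡⟨ ∑-cong G (λ p → trans (∑-distrib-+ G _ (invisible p)) (cong (_+ ∑ G (invisible p)) (∑-distrib-+ G _ _))) ⟩
    ∑[ p ∈ G ] (∑[ q ∈ G ] invisible p origin + ∑[ q ∈ G ] invisible q origin + ∑[ q ∈ G ] invisible p q)
      ≡⟨ trans (∑-distrib-+ G _ _) (cong (_+ c) (∑-distrib-+ G _ _)) ⟩
    a + b + c ∎
  covered : M * M ≤ ψ + (a + b + c)
  covered = begin
    M * M                                          ≡⟨ cong₂ _*_ (length-grid d N) (length-grid d N) ⟨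
    |G| * |G|                                      ≡⟨ length-cartesianProduct G G ⟨
    length G²                                      ≤⟨ length≤∑ G² (λ { (p , q) pq∈ → Ψ-or-invisible pq∈ }) ⟩
    ∑[ x ∈ G² ] (𝟙 (inΨ? N x) + blind x)           ≡⟨ ∑-distrib-+ G² (𝟙 ∘ inΨ? N) blind ⟩
    ∑[ x ∈ G² ] 𝟙 (inΨ? N x) + ∑ G² blind          ≡⟨ cong₂ _+_ (length-filter≡∑𝟙 (inΨ? N) G²) (sym ∑blind≡) ⟨
    ψ + (a + b + c)                                ∎
  6a≤ : 6 * a ≤ |G| * M
  6a≤ = subst (λ z → 6 * z ≤ |G| * M) (sym (∑-comm G G (λ p q → invisible p origin)))
          (rows-bound G G (λ q p → invisible p origin) 6 M (λ _ _ → count-¬visible origin 4≤N 8≤d origin-bounded))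
  6b≤ : 6 * b ≤ |G| * M
  6b≤ = rows-bound G G (λ p q → invisible q origin) 6 M (λ _ _ → count-¬visible origin 4≤N 8≤d origin-bounded)
  6c≤ : 6 * c ≤ |G| * M
  6c≤ = subst (λ z → 6 * z ≤ |G| * M) (sym (∑-comm G G invisible))
          (rows-bound G G (λ q p → invisible p q) 6 M (λ q q∈ → count-¬visible q 4≤N 8≤d (∈-grid⁻ d N q∈)))

-- Second moments of coordinate sums

coordSum : (ℕ → ℕ → ℕ) → ∀ {d} → Pt d → Pt d → ℕ
coordSum a []      []      = 0
coordSum a (x ∷ p) (y ∷ q) = a x y + coordSum a p q


module SecondMoment where
  open import Data.Integer as ℤ using (ℤ; +_; -[1+_]; 0ℤ; _⊖_)
  import Data.Integer.Properties as ℤP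
  import Data.Integer.Tactic.RingSolver as ℤ-Ring

  ∑-pos : ∀ (xs : List A) (f : A → ℕ) → ℤ∑.∑[ x ∈ xs ] (+ f x) ≡ + ∑ xs f
  ∑-pos []       f = refl
  ∑-pos (x ∷ xs) f = trans (cong (ℤ._+_ (+ f x)) (∑-pos xs f)) (sym (ℤP.pos-+ (f x) (∑ xs f)))

  ∑ᶻ-const : ∀ (xs : List A) k → ℤ∑.∑[ x ∈ xs ] k ≡ + length xs ℤ.* k
  ∑ᶻ-const []       k = sym (ℤP.*-zeroˡ k)
  ∑ᶻ-const (x ∷ xs) k = trans (cong (ℤ._+_ k) (∑ᶻ-const xs k)) (sym (ℤP.suc-* (+ length xs) k))

  module CentredSums (N : ℕ) (h : ℕ → ℕ → ℤ) where

    U = upTo (suc N)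

    hSum : ∀ {d} → Pt d → Pt d → ℤ
    hSum []      []      = 0ℤ
    hSum (x ∷ p) (y ∷ q) = h x y ℤ.+ hSum p q

    hSum² : ∀ {d} → Pt d → Pt d → ℤ
    hSum² p q = hSum p q ℤ.* hSum p q

    ∑² : ∀ d → (Pt d → Pt d → ℤ) → ℤ
    ∑² d F = ℤ∑.∑[ p ∈ grid d N ] ℤ∑.∑[ q ∈ grid d N ] F p q

    ∑²-suc : ∀ d (F : Pt (suc d) → Pt (suc d) → ℤ) →
      ∑² (suc d) F ≡ ℤ∑.∑[ x ∈ U ] ℤ∑.∑[ y ∈ U ] ∑² d (λ p q → F (x ∷ p) (y ∷ q))
    ∑²-suc d F = begin
      ∑² (suc d) F
        ≡⟨ ℤ∑.∑-grid d N _ ⟩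
      ℤ∑.∑[ x ∈ U ] ℤ∑.∑[ p ∈ G ] ℤ∑.∑[ q ∈ grid (suc d) N ] F (x ∷ p) q
        ≡⟨ ℤ∑.∑-cong U (λ x → ℤ∑.∑-cong G (λ p → ℤ∑.∑-grid d N (F (x ∷ p)))) ⟩
      ℤ∑.∑[ x ∈ U ] ℤ∑.∑[ p ∈ G ] ℤ∑.∑[ y ∈ U ] ℤ∑.∑[ q ∈ G ] F (x ∷ p) (y ∷ q)
        ≡⟨ ℤ∑.∑-cong U (λ x → ℤ∑.∑-comm G U (λ p y → ℤ∑.∑[ q ∈ G ] F (x ∷ p) (y ∷ q))) ⟩
      ℤ∑.∑[ x ∈ U ] ℤ∑.∑[ y ∈ U ] ∑² d (λ p q → F (x ∷ p) (y ∷ q)) ∎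
      where
      open ≡-Reasoning
      G = grid d N

    ∑²-distrib-+ : ∀ d (F F′ : Pt d → Pt d → ℤ) → ∑² d (λ p q → F p q ℤ.+ F′ p q) ≡ ∑² d F ℤ.+ ∑² d F′
    ∑²-distrib-+ d F F′ = trans (ℤ∑.∑-cong (grid d N) (λ p → ℤ∑.∑-distrib-+ (grid d N) (F p) (F′ p)))
                                (ℤ∑.∑-distrib-+ (grid d N) _ _)

    ∑²-distribˡ : ∀ d k (F : Pt d → Pt d → ℤ) → ∑² d (λ p q → k ℤ.* F p q) ≡ k ℤ.* ∑² d F
    ∑²-distribˡ d k F = trans (ℤ∑.∑-cong (grid d N) (λ p → ℤ∑.∑-distribˡ (grid d N) k (F p)))
                              (ℤ∑.∑-distribˡ (grid d N) k _)

    ∑²-const : ∀ d k → ∑² d (λ _ _ → k) ≡ + (suc N ^ d * suc N ^ d) ℤ.* k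
    ∑²-const d k = begin
      ∑² d (λ _ _ → k)                   ≡⟨ ℤ∑.∑-cong G (λ _ → ∑ᶻ-const G k) ⟩
      ℤ∑.∑[ p ∈ G ] (+ length G ℤ.* k)   ≡⟨ ∑ᶻ-const G _ ⟩
      + length G ℤ.* (+ length G ℤ.* k)  ≡⟨ sym (ℤP.*-assoc (+ length G) _ k) ⟩
      + length G ℤ.* + length G ℤ.* k    ≡⟨ cong (ℤ._* k) (sym (ℤP.pos-* (length G) (length G))) ⟩
      + (length G * length G) ℤ.* k      ≡⟨ cong (λ m → + (m * m) ℤ.* k) (length-grid d N) ⟩
      + (suc N ^ d * suc N ^ d) ℤ.* k    ∎
      where
      open ≡-Reasoning
      G = grid d N

    module _ (centred : ℤ∑.∑[ x ∈ U ] ℤ∑.∑[ y ∈ U ] h x y ≡ 0ℤ) where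

      ∑²-hSum : ∀ d → ∑² d hSum ≡ 0ℤ
      ∑²-hSum zero    = refl
      ∑²-hSum (suc d) = begin
        ∑² (suc d) hSum
          ≡⟨ ∑²-suc d hSum ⟩
        ℤ∑.∑[ x ∈ U ] ℤ∑.∑[ y ∈ U ] ∑² d (λ p q → h x y ℤ.+ hSum p q)
          ≡⟨ ℤ∑.∑-cong U (λ x → ℤ∑.∑-cong U (λ y → split x y)) ⟩
        ℤ∑.∑[ x ∈ U ] ℤ∑.∑[ y ∈ U ] (K ℤ.* h x y)
          ≡⟨ trans (ℤ∑.∑-cong U (λ x → ℤ∑.∑-distribˡ U K (h x))) (ℤ∑.∑-distribˡ U K _) ⟩
        K ℤ.* ℤ∑.∑[ x ∈ U ] ℤ∑.∑[ y ∈ U ] h x y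
          ≡⟨ trans (cong (K ℤ.*_) centred) (ℤP.*-zeroʳ K) ⟩
        0ℤ ∎
        where
        open ≡-Reasoning
        K = + (suc N ^ d * suc N ^ d)
        split : ∀ x y → ∑² d (λ p q → h x y ℤ.+ hSum p q) ≡ K ℤ.* h x y
        split x y = begin
          ∑² d (λ p q → h x y ℤ.+ hSum p q)  ≡⟨ ∑²-distrib-+ d (λ _ _ → h x y) hSum ⟩
          ∑² d (λ _ _ → h x y) ℤ.+ ∑² d hSum ≡⟨ cong₂ ℤ._+_ (∑²-const d (h x y)) (∑²-hSum d) ⟩
          K ℤ.* h x y ℤ.+ 0ℤ                 ≡⟨ ℤP.+-identityʳ _ ⟩
          K ℤ.* h x y                        ∎

      -- The cross terms vanish because hSum is centred, so the second moment adds up over coordinates.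
      ∑²-hSum²-suc : ∀ d → ∑² (suc d) hSum² ≡
        + (suc N ^ d * suc N ^ d) ℤ.* ℤ∑.∑[ x ∈ U ] ℤ∑.∑[ y ∈ U ] (h x y ℤ.* h x y)
          ℤ.+ + (suc N * suc N) ℤ.* ∑² d hSum²
      ∑²-hSum²-suc d = begin
        ∑² (suc d) hSum²
          ≡⟨ ∑²-suc d hSum² ⟩
        ℤ∑.∑[ x ∈ U ] ℤ∑.∑[ y ∈ U ] ∑² d (λ p q → (h x y ℤ.+ hSum p q) ℤ.* (h x y ℤ.+ hSum p q))
          ≡⟨ ℤ∑.∑-cong U (λ x → ℤ∑.∑-cong U (λ y → square x y)) ⟩
        ℤ∑.∑[ x ∈ U ] ℤ∑.∑[ y ∈ U ] (K ℤ.* (h x y ℤ.* h x y) ℤ.+ V)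
          ≡⟨ ℤ∑.∑-cong U (λ x → trans (ℤ∑.∑-distrib-+ U (λ y → K ℤ.* hh x y) (λ _ → V))
                                      (cong₂ ℤ._+_ (ℤ∑.∑-distribˡ U K (hh x)) (∑ᶻ-const U V))) ⟩
        ℤ∑.∑[ x ∈ U ] (K ℤ.* ℤ∑.∑[ y ∈ U ] (h x y ℤ.* h x y) ℤ.+ + length U ℤ.* V)
          ≡⟨ trans (ℤ∑.∑-distrib-+ U (λ x → K ℤ.* ℤ∑.∑ U (hh x)) (λ _ → + length U ℤ.* V))
                   (cong₂ ℤ._+_ (ℤ∑.∑-distribˡ U K (λ x → ℤ∑.∑ U (hh x))) (∑ᶻ-const U _)) ⟩
        K ℤ.* ℤ∑.∑[ x ∈ U ] ℤ∑.∑[ y ∈ U ] (h x y ℤ.* h x y) ℤ.+ + length U ℤ.* (+ length U ℤ.* V)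
          ≡⟨ cong (λ n → K ℤ.* ∑hh ℤ.+ + n ℤ.* (+ n ℤ.* V)) (length-upTo (suc N)) ⟩
        K ℤ.* ℤ∑.∑[ x ∈ U ] ℤ∑.∑[ y ∈ U ] (h x y ℤ.* h x y) ℤ.+ + suc N ℤ.* (+ suc N ℤ.* V)
          ≡⟨ cong (ℤ._+_ (K ℤ.* ∑hh)) (trans (sym (ℤP.*-assoc (+ suc N) (+ suc N) V)) (cong (ℤ._* V) (sym (ℤP.pos-* (suc N) (suc N))))) ⟩
        K ℤ.* ℤ∑.∑[ x ∈ U ] ℤ∑.∑[ y ∈ U ] (h x y ℤ.* h x y) ℤ.+ + (suc N * suc N) ℤ.* V ∎
        where
        open ≡-Reasoning
        K = + (suc N ^ d * suc N ^ d)
        V = ∑² d hSum²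
        hh : ℕ → ℕ → ℤ
        hh x y = h x y ℤ.* h x y
        ∑hh = ℤ∑.∑[ x ∈ U ] ℤ∑.∑[ y ∈ U ] hh x y
        expand : ∀ a s → (a ℤ.+ s) ℤ.* (a ℤ.+ s) ≡ a ℤ.* a ℤ.+ (+ 2 ℤ.* a) ℤ.* s ℤ.+ s ℤ.* s
        expand = ℤ-Ring.solve-∀
        square : ∀ x y → ∑² d (λ p q → (h x y ℤ.+ hSum p q) ℤ.* (h x y ℤ.+ hSum p q)) ≡ K ℤ.* (h x y ℤ.* h x y) ℤ.+ V
        square x y = begin
          ∑² d (λ p q → (a ℤ.+ hSum p q) ℤ.* (a ℤ.+ hSum p q))
            ≡⟨ ℤ∑.∑-cong G (λ p → ℤ∑.∑-cong G (λ q → expand a (hSum p q))) ⟩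
          ∑² d (λ p q → a ℤ.* a ℤ.+ (+ 2 ℤ.* a) ℤ.* hSum p q ℤ.+ hSum² p q)
            ≡⟨ trans (∑²-distrib-+ d _ hSum²) (cong (ℤ._+ V) (∑²-distrib-+ d _ _)) ⟩
          ∑² d (λ _ _ → a ℤ.* a) ℤ.+ ∑² d (λ p q → (+ 2 ℤ.* a) ℤ.* hSum p q) ℤ.+ V
            ≡⟨ cong (λ z → z ℤ.+ V) (cong₂ ℤ._+_ (∑²-const d (a ℤ.* a))
                 (trans (∑²-distribˡ d (+ 2 ℤ.* a) hSum) (cong (+ 2 ℤ.* a ℤ.*_) (∑²-hSum d)))) ⟩
          K ℤ.* (a ℤ.* a) ℤ.+ (+ 2 ℤ.* a) ℤ.* 0ℤ ℤ.+ V
            ≡⟨ cong (λ z → K ℤ.* (a ℤ.* a) ℤ.+ z ℤ.+ V) (ℤP.*-zeroʳ (+ 2 ℤ.* a)) ⟩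
          K ℤ.* (a ℤ.* a) ℤ.+ 0ℤ ℤ.+ V
            ≡⟨ cong (ℤ._+ V) (ℤP.+-identityʳ (K ℤ.* (a ℤ.* a))) ⟩
          K ℤ.* (a ℤ.* a) ℤ.+ V ∎
          where
          a = h x y
          G = grid d N

  ⊖-+-⊖ : ∀ a b c e → (a ⊖ b) ℤ.+ (c ⊖ e) ≡ (a + c) ⊖ (b + e)
  ⊖-+-⊖ a b c e = begin
    (a ⊖ b) ℤ.+ (c ⊖ e)                       ≡⟨ cong₂ ℤ._+_ (ℤP.[+m]-[+n]≡m⊖n a b) (ℤP.[+m]-[+n]≡m⊖n c e) ⟨
    (+ a ℤ.- + b) ℤ.+ (+ c ℤ.- + e)           ≡⟨ regroup (+ a) (+ b) (+ c) (+ e) ⟩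
    (+ a ℤ.+ + c) ℤ.- (+ b ℤ.+ + e)           ≡⟨ cong₂ ℤ._-_ (ℤP.pos-+ a c) (ℤP.pos-+ b e) ⟨
    + (a + c) ℤ.- + (b + e)                   ≡⟨ ℤP.[+m]-[+n]≡m⊖n (a + c) (b + e) ⟩
    (a + c) ⊖ (b + e)                         ∎
    where
    open ≡-Reasoning
    regroup : ∀ a b c e → (a ℤ.- b) ℤ.+ (c ℤ.- e) ≡ (a ℤ.+ c) ℤ.- (b ℤ.+ e)
    regroup = ℤ-Ring.solve-∀

  ∣⊖∣≡∣-∣ : ∀ m n → ℤ.∣ m ⊖ n ∣ ≡ ∣ m - n ∣
  ∣⊖∣≡∣-∣ zero    zero    = refl
  ∣⊖∣≡∣-∣ zero    (suc n) = refl
  ∣⊖∣≡∣-∣ (suc m) zero    = refl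
  ∣⊖∣≡∣-∣ (suc m) (suc n) = trans (cong ℤ.∣_∣ (ℤP.[1+m]⊖[1+n]≡m⊖n m n)) (∣⊖∣≡∣-∣ m n)

  +∣i∣*∣i∣≡i*i : ∀ i → + (ℤ.∣ i ∣ * ℤ.∣ i ∣) ≡ i ℤ.* i
  +∣i∣*∣i∣≡i*i (+ n)    = ℤP.pos-* n n
  +∣i∣*∣i∣≡i*i -[1+ n ] = refl

  ∑ᶻ-⊖ : ∀ (xs : List A) (f : A → ℕ) k → ℤ∑.∑[ x ∈ xs ] (f x ⊖ k) ≡ ∑ xs f ⊖ (length xs * k)
  ∑ᶻ-⊖ []       f k = refl
  ∑ᶻ-⊖ (x ∷ xs) f k = trans (cong (ℤ._+_ (f x ⊖ k)) (∑ᶻ-⊖ xs f k)) (⊖-+-⊖ (f x) k (∑ xs f) (length xs * k))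

  module _ (N : ℕ) (a : ℕ → ℕ → ℕ) (c s : ℕ)
           (mean : ∑[ x ∈ upTo (suc N) ] ∑[ y ∈ upTo (suc N) ] a x y ≡ suc N * (suc N * c))
           (spread : ∀ x y → x ≤ N → y ≤ N → ∣ a x y - c ∣ ≤ s) where

    private
      h : ℕ → ℕ → ℤ
      h x y = a x y ⊖ c
      open CentredSums N h

      centred : ℤ∑.∑[ x ∈ U ] ℤ∑.∑[ y ∈ U ] h x y ≡ 0ℤ
      centred = begin
        ℤ∑.∑[ x ∈ U ] ℤ∑.∑[ y ∈ U ] h x y                ≡⟨ ℤ∑.∑-cong U (λ x → ∑ᶻ-⊖ U (a x) c) ⟩
        ℤ∑.∑[ x ∈ U ] (∑ U (a x) ⊖ (length U * c))        ≡⟨ ∑ᶻ-⊖ U (λ x → ∑ U (a x)) (length U * c) ⟩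
        ∑[ x ∈ U ] ∑ U (a x) ⊖ (length U * (length U * c)) ≡⟨ cong₂ (λ S n → S ⊖ (n * (n * c))) mean (length-upTo (suc N)) ⟩
        suc N * (suc N * c) ⊖ (suc N * (suc N * c))       ≡⟨ ℤP.n⊖n≡0 (suc N * (suc N * c)) ⟩
        0ℤ                                                ∎
        where open ≡-Reasoning

      hSum≡⊖ : ∀ {d} (p q : Pt d) → hSum p q ≡ coordSum a p q ⊖ (d * c)
      hSum≡⊖ []      []      = refl
      hSum≡⊖ (x ∷ p) (y ∷ q) = trans (cong (ℤ._+_ (h x y)) (hSum≡⊖ p q)) (⊖-+-⊖ (a x y) c (coordSum a p q) _)

      deviation : ∀ {d} → Pt d → Pt d → ℕ
      deviation {d} p q = ∣ coordSum a p q - d * c ∣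

      moment : ℕ → ℕ
      moment d = ∑[ p ∈ grid d N ] ∑[ q ∈ grid d N ] (deviation p q * deviation p q)

      +moment : ∀ d → + moment d ≡ ∑² d hSum²
      +moment d = begin
        + moment d                          ≡⟨ ∑-pos (grid d N) _ ⟨
        ℤ∑.∑[ p ∈ G ] (+ ∑[ q ∈ G ] (deviation p q * deviation p q))
                                            ≡⟨ ℤ∑.∑-cong G (λ p → sym (∑-pos G _)) ⟩
        ℤ∑.∑[ p ∈ G ] ℤ∑.∑[ q ∈ G ] (+ (deviation p q * deviation p q))
                                            ≡⟨ ℤ∑.∑-cong G (λ p → ℤ∑.∑-cong G (λ q → square p q)) ⟩
        ∑² d hSum²                          ∎
        where
        open ≡-Reasoning
        G = grid d N
        square : ∀ p q → + (deviation p q * deviation p q) ≡ hSum² p q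
        square p q = begin
          + (deviation p q * deviation p q)
            ≡⟨ cong (λ n → + (n * n)) (trans (sym (∣⊖∣≡∣-∣ (coordSum a p q) (d * c))) (cong ℤ.∣_∣ (sym (hSum≡⊖ p q)))) ⟩
          + (ℤ.∣ hSum p q ∣ * ℤ.∣ hSum p q ∣)
            ≡⟨ +∣i∣*∣i∣≡i*i (hSum p q) ⟩
          hSum² p q ∎

      one-dim : ℕ
      one-dim = ∑[ x ∈ U ] ∑[ y ∈ U ] (∣ a x y - c ∣ * ∣ a x y - c ∣)

      +one-dim : + one-dim ≡ ℤ∑.∑[ x ∈ U ] ℤ∑.∑[ y ∈ U ] (h x y ℤ.* h x y)
      +one-dim = trans (sym (∑-pos U _)) (ℤ∑.∑-cong U λ x → trans (sym (∑-pos U _)) (ℤ∑.∑-cong U λ y →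
        trans (cong (λ n → + (n * n)) (sym (∣⊖∣≡∣-∣ (a x y) c))) (+∣i∣*∣i∣≡i*i (h x y))))

      moment-suc : ∀ d → moment (suc d) ≡ (suc N ^ d * suc N ^ d) * one-dim + (suc N * suc N) * moment d
      moment-suc d = ℤP.+-injective (begin
        + moment (suc d)                                    ≡⟨ +moment (suc d) ⟩
        ∑² (suc d) hSum²                                    ≡⟨ ∑²-hSum²-suc centred d ⟩
        + K ℤ.* ℤ∑.∑[ x ∈ U ] ℤ∑.∑[ y ∈ U ] (h x y ℤ.* h x y) ℤ.+ + L ℤ.* ∑² d hSum²
                                                            ≡⟨ cong₂ (λ u v → + K ℤ.* u ℤ.+ + L ℤ.* v) (sym +one-dim) (sym (+moment d)) ⟩
        + K ℤ.* + one-dim ℤ.+ + L ℤ.* + moment d            ≡⟨ cong₂ ℤ._+_ (ℤP.pos-* K one-dim) (ℤP.pos-* L (moment d)) ⟨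
        + (K * one-dim) ℤ.+ + (L * moment d)                ≡⟨ ℤP.pos-+ (K * one-dim) (L * moment d) ⟨
        + (K * one-dim + L * moment d)                      ∎)
        where
        open ≡-Reasoning
        K = suc N ^ d * suc N ^ d
        L = suc N * suc N

      one-dim≤ : one-dim ≤ suc N * (suc N * (s * s))
      one-dim≤ = begin
        one-dim                          ≤⟨ ∑-mono-≤ U (λ x x∈ → ∑-mono-≤ U (λ y y∈ → square≤ x∈ y∈)) ⟩
        ∑[ x ∈ U ] ∑[ y ∈ U ] (s * s)    ≡⟨ trans (∑-cong U λ _ → ∑-const U (s * s)) (∑-const U _) ⟩
        length U * (length U * (s * s))  ≡⟨ cong (λ n → n * (n * (s * s))) (length-upTo (suc N)) ⟩
        suc N * (suc N * (s * s))        ∎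
        where
        open ≤-Reasoning
        square≤ : ∀ {x y} → x ∈ U → y ∈ U → ∣ a x y - c ∣ * ∣ a x y - c ∣ ≤ s * s
        square≤ {x} {y} x∈ y∈ = *-mono-≤ dev dev
          where dev = spread x y (s≤s⁻¹ (∈-upTo⁻ x∈)) (s≤s⁻¹ (∈-upTo⁻ y∈))

    second-moment : ∀ d →
      ∑[ p ∈ grid d N ] ∑[ q ∈ grid d N ] (∣ coordSum a p q - d * c ∣ * ∣ coordSum a p q - d * c ∣)
        ≤ d * (suc N ^ d * suc N ^ d) * (s * s)
    second-moment zero    = z≤n
    second-moment (suc d) = begin
      moment (suc d)
        ≡⟨ moment-suc d ⟩
      M² * one-dim + (suc N * suc N) * moment d
        ≤⟨ +-mono-≤ (*-monoʳ-≤ M² one-dim≤) (*-monoʳ-≤ (suc N * suc N) (second-moment d)) ⟩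
      M² * (suc N * (suc N * (s * s))) + (suc N * suc N) * (d * M² * (s * s))
        ≡⟨ collect M (suc N) s d ⟩
      suc d * ((suc N * M) * (suc N * M)) * (s * s) ∎
      where
      open ≤-Reasoning
      M = suc N ^ d
      M² = M * M
      collect : ∀ m n s d → (m * m) * (n * (n * (s * s))) + (n * n) * (d * (m * m) * (s * s))
                          ≡ (1 + d) * ((n * m) * (n * m)) * (s * s)
      collect = solve-∀

open SecondMoment using (second-moment)

-- Concentration of |p|², |q|² and ⟨p,q⟩

chebyshev : ∀ (xs : List A) (f : A → ℕ) m K →
  K * K * length (filter (λ x → K <? m * f x) xs) ≤ m * m * ∑[ x ∈ xs ] (f x * f x)
chebyshev xs f m K = begin
  K * K * length (filter (λ x → K <? m * f x) xs)   ≤⟨ markov (λ x → K <? m * f x) (K * K) (λ x → m * m * (f x * f x)) xs square ⟩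
  ∑[ x ∈ xs ] (m * m * (f x * f x))                 ≡⟨ ∑-distribˡ xs (m * m) (λ x → f x * f x) ⟩
  m * m * ∑[ x ∈ xs ] (f x * f x)                   ∎
  where
  open ≤-Reasoning
  regroup : ∀ m v → (m * v) * (m * v) ≡ m * m * (v * v)
  regroup = solve-∀
  square : ∀ x → K < m * f x → K * K ≤ m * m * (f x * f x)
  square x K<mf = ≤-trans (*-mono-≤ (<⇒≤ K<mf) (<⇒≤ K<mf)) (≤-reflexive (regroup m (f x)))

∑-upTo-6x² : ∀ N → ∑[ x ∈ upTo (suc N) ] (6 * (x * x)) ≡ N * suc N * (2 * N + 1)
∑-upTo-6x² zero    = refl
∑-upTo-6x² (suc N) = begin
  ∑[ x ∈ upTo (suc (suc N)) ] (6 * (x * x))          ≡⟨ ∑-upTo-suc (suc N) (λ x → 6 * (x * x)) ⟩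
  ∑[ x ∈ upTo (suc N) ] (6 * (x * x)) + 6 * (suc N * suc N) ≡⟨ cong (_+ 6 * (suc N * suc N)) (∑-upTo-6x² N) ⟩
  N * suc N * (2 * N + 1) + 6 * (suc N * suc N)     ≡⟨ step N ⟩
  suc N * suc (suc N) * (2 * suc N + 1)             ∎
  where
  open ≡-Reasoning
  step : ∀ n → n * (1 + n) * (2 * n + 1) + 6 * ((1 + n) * (1 + n)) ≡ (1 + n) * (2 + n) * (2 * (1 + n) + 1)
  step = solve-∀

∑-upTo-2x : ∀ N → 2 * ∑[ x ∈ upTo (suc N) ] x ≡ N * suc N
∑-upTo-2x zero    = refl
∑-upTo-2x (suc N) = begin
  2 * ∑[ x ∈ upTo (suc (suc N)) ] x        ≡⟨ cong (2 *_) (∑-upTo-suc (suc N) (λ x → x)) ⟩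
  2 * (∑[ x ∈ upTo (suc N) ] x + suc N)    ≡⟨ *-distribˡ-+ 2 (∑[ x ∈ upTo (suc N) ] x) (suc N) ⟩
  2 * ∑[ x ∈ upTo (suc N) ] x + 2 * suc N  ≡⟨ cong (_+ 2 * suc N) (∑-upTo-2x N) ⟩
  N * suc N + 2 * suc N                    ≡⟨ step N ⟩
  suc N * suc (suc N)                      ∎
  where
  open ≡-Reasoning
  step : ∀ n → n * (1 + n) + 2 * (1 + n) ≡ (1 + n) * (2 + n)
  step = solve-∀

deviant-count : ∀ N (a : ℕ → ℕ → ℕ) c s →
  ∑[ x ∈ upTo (suc N) ] ∑[ y ∈ upTo (suc N) ] a x y ≡ suc N * (suc N * c) →
  (∀ x y → x ≤ N → y ≤ N → ∣ a x y - c ∣ ≤ s) →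
  ∀ d (X : Pt d → Pt d → ℕ) → (∀ p q → coordSum a p q ≡ X p q) → ∀ m K →
  K * K * length (filter (λ x → K <? m * ∣ X (proj₁ x) (proj₂ x) - d * c ∣) (cartesianProduct (grid d N) (grid d N)))
    ≤ m * m * (d * (suc N ^ d * suc N ^ d) * (s * s))
deviant-count N a c s mean spread d X X≡ m K = begin
  K * K * length (filter (λ x → K <? m * dev x) G²) ≤⟨ chebyshev G² dev m K ⟩
  m * m * ∑[ x ∈ G² ] (dev x * dev x)              ≡⟨ cong (m * m *_) (∑-cartesianProduct G G (λ x → dev x * dev x)) ⟩
  m * m * ∑[ p ∈ G ] ∑[ q ∈ G ] (dev (p , q) * dev (p , q))
                                                  ≡⟨ cong (m * m *_) (∑-cong G λ p → ∑-cong G λ q →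
                                                       cong (λ z → ∣ z - d * c ∣ * ∣ z - d * c ∣) (sym (X≡ p q))) ⟩
  m * m * ∑[ p ∈ G ] ∑[ q ∈ G ] (∣ coordSum a p q - d * c ∣ * ∣ coordSum a p q - d * c ∣)
                                                  ≤⟨ *-monoʳ-≤ (m * m) (second-moment N a c s mean spread d) ⟩
  m * m * (d * (suc N ^ d * suc N ^ d) * (s * s)) ∎
  where
  open ≤-Reasoning
  G = grid d N
  G² = cartesianProduct G G
  dev : Pt d × Pt d → ℕ
  dev x = ∣ X (proj₁ x) (proj₂ x) - d * c ∣

∣-∣≤ : ∀ {u v s} → u ≤ s → v ≤ s → ∣ u - v ∣ ≤ s
∣-∣≤ {u} {v} u≤s v≤s = ≤-trans (∣m-n∣≤m⊔n u v) (⊔-lub u≤s v≤s)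

N[2N+1]≤6N² : ∀ N → N * (2 * N + 1) ≤ 6 * (N * N)
N[2N+1]≤6N² zero    = z≤n
N[2N+1]≤6N² (suc n) = ≤-trans (m≤m+n _ (4 * (n * n) + 7 * n + 3)) (≤-reflexive (slack n))
  where
  slack : ∀ n → (1 + n) * (2 * (1 + n) + 1) + (4 * (n * n) + 7 * n + 3) ≡ 6 * ((1 + n) * (1 + n))
  slack = solve-∀

x≤N⇒6x²≤6N² : ∀ {x N} → x ≤ N → 6 * (x * x) ≤ 6 * (N * N)
x≤N⇒6x²≤6N² x≤N = *-monoʳ-≤ 6 (*-mono-≤ x≤N x≤N)

dot-coordSum : ∀ k {d} (p q : Pt d) → (coordSum (λ x y → k * (x * y)) p q ≡ k * dot p q)
                                    × (coordSum (λ x _ → k * (x * x)) p q ≡ k * dot p p)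
                                    × (coordSum (λ _ y → k * (y * y)) p q ≡ k * dot q q)
dot-coordSum k []      []      = sym (*-zeroʳ k) , sym (*-zeroʳ k) , sym (*-zeroʳ k)
dot-coordSum k (x ∷ p) (y ∷ q) with pq , pp , qq ← dot-coordSum k p q =
    trans (cong (k * (x * y) +_) pq) (sym (*-distribˡ-+ k (x * y) (dot p q)))
  , trans (cong (k * (x * x) +_) pp) (sym (*-distribˡ-+ k (x * x) (dot p p)))
  , trans (cong (k * (y * y) +_) qq) (sym (*-distribˡ-+ k (y * y) (dot q q)))

module _ (N : ℕ) where
  private
    U = upTo (suc N)

  mean-6x² : ∑[ x ∈ U ] ∑[ y ∈ U ] (6 * (x * x)) ≡ suc N * (suc N * (N * (2 * N + 1)))
  mean-6x² = begin
    ∑[ x ∈ U ] ∑[ y ∈ U ] (6 * (x * x))      ≡⟨ ∑-cong U (λ x → ∑-const U _) ⟩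
    ∑[ x ∈ U ] (length U * (6 * (x * x)))    ≡⟨ ∑-distribˡ U (length U) _ ⟩
    length U * ∑[ x ∈ U ] (6 * (x * x))      ≡⟨ cong₂ _*_ (length-upTo (suc N)) (∑-upTo-6x² N) ⟩
    suc N * (N * suc N * (2 * N + 1))        ≡⟨ cong (suc N *_) (regroup N) ⟩
    suc N * (suc N * (N * (2 * N + 1)))      ∎
    where
    open ≡-Reasoning
    regroup : ∀ n → n * (1 + n) * (2 * n + 1) ≡ (1 + n) * (n * (2 * n + 1))
    regroup = solve-∀

  mean-6y² : ∑[ x ∈ U ] ∑[ y ∈ U ] (6 * (y * y)) ≡ suc N * (suc N * (N * (2 * N + 1)))
  mean-6y² = trans (∑-comm U U (λ x y → 6 * (y * y))) mean-6x²

  mean-4xy : ∑[ x ∈ U ] ∑[ y ∈ U ] (4 * (x * y)) ≡ suc N * (suc N * (N * N))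
  mean-4xy = begin
    ∑[ x ∈ U ] ∑[ y ∈ U ] (4 * (x * y))
      ≡⟨ ∑-cong U (λ x → trans (∑-cong U (λ y → sym (*-assoc 4 x y))) (∑-distribˡ U (4 * x) (λ y → y))) ⟩
    ∑[ x ∈ U ] (4 * x * S)               ≡⟨ trans (∑-cong U (λ x → *-comm (4 * x) S)) (∑-distribˡ U S (4 *_)) ⟩
    S * ∑[ x ∈ U ] (4 * x)               ≡⟨ cong (S *_) (∑-distribˡ U 4 (λ x → x)) ⟩
    S * (4 * S)                          ≡⟨ square S ⟩
    (2 * S) * (2 * S)                    ≡⟨ cong (λ z → z * z) (∑-upTo-2x N) ⟩
    N * suc N * (N * suc N)              ≡⟨ regroup N ⟩
    suc N * (suc N * (N * N))            ∎
    where
    open ≡-Reasoning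
    S = ∑[ x ∈ U ] x
    square : ∀ s → s * (4 * s) ≡ (2 * s) * (2 * s)
    square = solve-∀
    regroup : ∀ n → n * (1 + n) * (n * (1 + n)) ≡ (1 + n) * ((1 + n) * (n * n))
    regroup = solve-∀

  spread-6x² : ∀ x y → x ≤ N → y ≤ N → ∣ 6 * (x * x) - N * (2 * N + 1) ∣ ≤ 6 * (N * N)
  spread-6x² x y x≤N _ = ∣-∣≤ (x≤N⇒6x²≤6N² x≤N) (N[2N+1]≤6N² N)

  spread-6y² : ∀ x y → x ≤ N → y ≤ N → ∣ 6 * (y * y) - N * (2 * N + 1) ∣ ≤ 6 * (N * N)
  spread-6y² x y _ y≤N = ∣-∣≤ (x≤N⇒6x²≤6N² y≤N) (N[2N+1]≤6N² N)

  spread-4xy : ∀ x y → x ≤ N → y ≤ N → ∣ 4 * (x * y) - N * N ∣ ≤ 6 * (N * N)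
  spread-4xy x y x≤N y≤N = ∣-∣≤ (*-mono-≤ (≤ᵇ⇒≤ 4 6 _) (*-mono-≤ x≤N y≤N)) (m≤n*m (N * N) 6)

-- The angle between typical points

m*∣x-c∣≤k⇒ : ∀ m k x c → m * ∣ x - c ∣ ≤ k → m * c ≤ m * x + k × m * x ≤ m * c + k
m*∣x-c∣≤k⇒ m k x c m∣x-c∣≤k =
    ≤-trans (*-monoʳ-≤ m (m≤n+∣m-n∣ c x)) (≤-trans (≤-reflexive (*-distribˡ-+ m x _))
      (+-monoʳ-≤ (m * x) (≤-trans (≤-reflexive (cong (m *_) (∣-∣-comm c x))) m∣x-c∣≤k)))
  , ≤-trans (*-monoʳ-≤ m (m≤n+∣m-n∣ x c)) (≤-trans (≤-reflexive (*-distribˡ-+ m c _)) (+-monoʳ-≤ (m * c) m∣x-c∣≤k))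

-- With L = l + 1 and m = 4L, the hypotheses put 6A and 6B in [2 − 1/m, 2 + 2/m]·dN² and 4D in
-- [1 − 1/m, 1 + 1/m]·dN², whence |D²/(AB) − 9/16| ≤ 1/L.  The polynomial slacks in l turn the final
-- comparisons of constants into semiring identities.
module Cos²Bounds (l N d A B D : ℕ) where
  private
    L = suc l
    m = 4 * L
    K = d * (N * N)
    μ = N * (2 * N + 1)

  module _ (m≤N : m ≤ N)
           (A-close : m * ∣ 6 * A - d * μ ∣ ≤ K)
           (B-close : m * ∣ 6 * B - d * μ ∣ ≤ K)
           (D-close : m * ∣ 4 * D - d * (N * N) ∣ ≤ K) where
    private
      α = 8 * l + 7
      mdN≤K : m * (d * N) ≤ K
      mdN≤K = ≤-trans (*-monoˡ-≤ (d * N) m≤N) (≤-reflexive (swap N d))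
        where
        swap : ∀ n d → n * (d * n) ≡ d * (n * n)
        swap = solve-∀
      mdμ≡ : m * (d * μ) ≡ α * K + K + m * (d * N)
      mdμ≡ = expand l N d
        where
        expand : ∀ l n d → (4 * (1 + l)) * (d * (n * (2 * n + 1))) ≡ (8 * l + 7) * (d * (n * n)) + d * (n * n) + (4 * (1 + l)) * (d * n)
        expand = solve-∀
      lower : ∀ X → m * ∣ X - d * μ ∣ ≤ K → α * K ≤ m * X
      lower X close with low , _ ← m*∣x-c∣≤k⇒ m K X (d * μ) close =
        +-cancelʳ-≤ K (α * K) (m * X) (≤-trans (≤-trans (m≤m+n (α * K + K) (m * (d * N))) (≤-reflexive (sym mdμ≡))) low)
      upper : ∀ X → m * ∣ X - d * μ ∣ ≤ K → m * X ≤ (2 * m + 2) * K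
      upper X close with _ , up ← m*∣x-c∣≤k⇒ m K X (d * μ) close = begin
        m * X                          ≤⟨ up ⟩
        m * (d * μ) + K                ≡⟨ cong (_+ K) mdμ≡ ⟩
        α * K + K + m * (d * N) + K    ≤⟨ +-monoˡ-≤ K (+-monoʳ-≤ (α * K + K) mdN≤K) ⟩
        α * K + K + K + K              ≡⟨ collect l K ⟩
        (2 * m + 2) * K                ∎
        where
        open ≤-Reasoning
        collect : ∀ l k → (8 * l + 7) * k + k + k + k ≡ (2 * (4 * (1 + l)) + 2) * k
        collect = solve-∀
      D-lower : (4 * l + 3) * K ≤ m * (4 * D)
      D-lower with low , _ ← m*∣x-c∣≤k⇒ m K (4 * D) K D-close =
        +-cancelʳ-≤ K _ _ (≤-trans (≤-reflexive (expand l K)) low)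
        where
        expand : ∀ l k → (4 * l + 3) * k + k ≡ (4 * (1 + l)) * k
        expand = solve-∀
      D-upper : m * (4 * D) ≤ (m + 1) * K
      D-upper with _ , up ← m*∣x-c∣≤k⇒ m K (4 * D) K D-close =
        ≤-trans up (≤-reflexive (sym (trans (*-distribʳ-+ K m 1) (cong (m * K +_) (*-identityˡ K)))))
      36m²≢0 : NonZero (36 * m * m)
      36m²≢0 = _
      sq-mono : ∀ {a b} → a ≤ b → a * a ≤ b * b
      sq-mono a≤b = *-mono-≤ a≤b a≤b

    cos²-upper : 16 * L * (D * D) ≤ (9 * L + 16) * (A * B)
    cos²-upper = *-cancelˡ-≤ (36 * m * m) {{36m²≢0}} (begin
      36 * m * m * (16 * L * (D * D))       ≡⟨ e₁ l (m) D ⟩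
      36 * L * ((m * (4 * D)) * (m * (4 * D))) ≤⟨ *-monoʳ-≤ (36 * L) (sq-mono D-upper) ⟩
      36 * L * ((m + 1) * K * ((m + 1) * K)) ≤⟨ ≤-trans (m≤m+n _ ((592 * (l * l) + 901 * l + 325) * (K * K))) (≤-reflexive (e₂ l K)) ⟩
      (9 * L + 16) * (α * K * (α * K))       ≤⟨ *-monoʳ-≤ (9 * L + 16) (*-mono-≤ (lower (6 * A) A-close) (lower (6 * B) B-close)) ⟩
      (9 * L + 16) * ((m * (6 * A)) * (m * (6 * B))) ≡⟨ e₃ (m) A B (9 * L + 16) ⟩
      36 * m * m * ((9 * L + 16) * (A * B)) ∎)
      where
      open ≤-Reasoning
      e₁ : ∀ l m x → 36 * m * m * (16 * (1 + l) * (x * x)) ≡ 36 * (1 + l) * ((m * (4 * x)) * (m * (4 * x)))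
      e₁ = solve-∀
      e₂ : ∀ l k → 36 * (1 + l) * ((4 * (1 + l) + 1) * k * ((4 * (1 + l) + 1) * k)) + (592 * (l * l) + 901 * l + 325) * (k * k)
                 ≡ (9 * (1 + l) + 16) * ((8 * l + 7) * k * ((8 * l + 7) * k))
      e₂ = solve-∀
      e₃ : ∀ m a b c → c * ((m * (6 * a)) * (m * (6 * b))) ≡ 36 * m * m * (c * (a * b))
      e₃ = solve-∀

    cos²-lower : 9 * L * (A * B) ≤ 16 * L * (D * D) + 16 * (A * B)
    cos²-lower = *-cancelˡ-≤ (36 * m * m) {{36m²≢0}} (begin
      36 * m * m * (9 * L * (A * B))
        ≡⟨ e₁ l m A B ⟩
      9 * L * ((m * (6 * A)) * (m * (6 * B)))
        ≤⟨ *-monoʳ-≤ (9 * L) (*-mono-≤ (upper (6 * A) A-close) (upper (6 * B) B-close)) ⟩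
      9 * L * ((2 * m + 2) * K * ((2 * m + 2) * K))
        ≤⟨ ≤-trans (m≤m+n _ ((448 * (l * l) + 640 * l + 208) * (K * K))) (≤-reflexive (e₂ l K)) ⟩
      36 * L * ((4 * l + 3) * K * ((4 * l + 3) * K)) + 16 * (α * K * (α * K))
        ≤⟨ +-mono-≤ (*-monoʳ-≤ (36 * L) (sq-mono D-lower))
                    (*-monoʳ-≤ 16 (*-mono-≤ (lower (6 * A) A-close) (lower (6 * B) B-close))) ⟩
      36 * L * ((m * (4 * D)) * (m * (4 * D))) + 16 * ((m * (6 * A)) * (m * (6 * B)))
        ≡⟨ e₃ l m A B D ⟩
      36 * m * m * (16 * L * (D * D) + 16 * (A * B)) ∎)
      where
      open ≤-Reasoning
      e₁ : ∀ l m a b → 36 * m * m * (9 * (1 + l) * (a * b)) ≡ 9 * (1 + l) * ((m * (6 * a)) * (m * (6 * b)))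
      e₁ = solve-∀
      e₂ : ∀ l k → 9 * (1 + l) * ((2 * (4 * (1 + l)) + 2) * k * ((2 * (4 * (1 + l)) + 2) * k)) + (448 * (l * l) + 640 * l + 208) * (k * k)
                 ≡ 36 * (1 + l) * ((4 * l + 3) * k * ((4 * l + 3) * k)) + 16 * ((8 * l + 7) * k * ((8 * l + 7) * k))
      e₂ = solve-∀
      e₃ : ∀ l m a b x → 36 * (1 + l) * ((m * (4 * x)) * (m * (4 * x))) + 16 * ((m * (6 * a)) * (m * (6 * b)))
                      ≡ 36 * m * m * (16 * (1 + l) * (x * x) + 16 * (a * b))
      e₃ = solve-∀

    A*B-pos : 1 ≤ N → 1 ≤ d → 1 ≤ A * B
    A*B-pos 1≤N 1≤d = *-mono-≤ (positive A A-close) (positive B B-close)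
      where
      1≤αK : 1 ≤ α * K
      1≤αK = *-mono-≤ (≤-trans (s≤s z≤n) (m≤n+m 7 (8 * l))) (*-mono-≤ 1≤d (*-mono-≤ 1≤N 1≤N))
      positive : ∀ Y → m * ∣ 6 * Y - d * μ ∣ ≤ K → 1 ≤ Y
      positive zero    close = ⊥-elim (<-irrefl refl (≤-trans 1≤αK (≤-trans (lower 0 close) (≤-reflexive (*-zeroʳ m)))))
      positive (suc Y) _     = s≤s z≤n

-- d·μ and d·N² are the means of 6|p|² and 4⟨p,q⟩ over 𝒲², and K/m = dN²/m is the tolerance.
module Deviance (d N m : ℕ) where
  K = d * (N * N)
  μ = N * (2 * N + 1)
  G² = cartesianProduct (grid d N) (grid d N)
  M = suc N ^ d

  deviantA? : (x : Pt d × Pt d) → Dec (K < m * ∣ 6 * dot (proj₁ x) (proj₁ x) - d * μ ∣)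
  deviantB? : (x : Pt d × Pt d) → Dec (K < m * ∣ 6 * dot (proj₂ x) (proj₂ x) - d * μ ∣)
  deviantD? : (x : Pt d × Pt d) → Dec (K < m * ∣ 4 * dot (proj₁ x) (proj₂ x) - d * (N * N) ∣)
  deviantA? x = K <? m * ∣ 6 * dot (proj₁ x) (proj₁ x) - d * μ ∣
  deviantB? x = K <? m * ∣ 6 * dot (proj₂ x) (proj₂ x) - d * μ ∣
  deviantD? x = K <? m * ∣ 4 * dot (proj₁ x) (proj₂ x) - d * (N * N) ∣

  cancel-K² : ∀ {count} → 1 ≤ d → 1 ≤ N →
    K * K * count ≤ m * m * (d * (M * M) * (6 * (N * N) * (6 * (N * N)))) → d * count ≤ 36 * (m * m) * (M * M)
  cancel-K² {count} 1≤d 1≤N bound = *-cancelʳ-≤ _ _ (d * (N * N * (N * N))) {{dN⁴≢0}} (begin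
    d * count * (d * (N * N * (N * N)))                        ≡⟨ lhs d count N ⟩
    K * K * count                                              ≤⟨ bound ⟩
    m * m * (d * (M * M) * (6 * (N * N) * (6 * (N * N))))     ≡⟨ rhs m d (M * M) N ⟩
    36 * (m * m) * (M * M) * (d * (N * N * (N * N)))           ∎)
    where
    open ≤-Reasoning
    dN⁴≢0 : NonZero (d * (N * N * (N * N)))
    dN⁴≢0 = >-nonZero (*-mono-≤ 1≤d (*-mono-≤ (*-mono-≤ 1≤N 1≤N) (*-mono-≤ 1≤N 1≤N)))
    lhs : ∀ d c n → d * c * (d * (n * n * (n * n))) ≡ d * (n * n) * (d * (n * n)) * c
    lhs = solve-∀
    rhs : ∀ m d x n → m * m * (d * x * (6 * (n * n) * (6 * (n * n)))) ≡ 36 * (m * m) * x * (d * (n * n * (n * n)))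
    rhs = solve-∀

  few-deviantA : 1 ≤ d → 1 ≤ N → d * length (filter deviantA? G²) ≤ 36 * (m * m) * (M * M)
  few-deviantA 1≤d 1≤N = cancel-K² 1≤d 1≤N
    (deviant-count N (λ x _ → 6 * (x * x)) μ (6 * (N * N)) (mean-6x² N) (spread-6x² N) d
                   (λ p _ → 6 * dot p p) (λ p q → proj₁ (proj₂ (dot-coordSum 6 p q))) m K)

  few-deviantB : 1 ≤ d → 1 ≤ N → d * length (filter deviantB? G²) ≤ 36 * (m * m) * (M * M)
  few-deviantB 1≤d 1≤N = cancel-K² 1≤d 1≤N
    (deviant-count N (λ _ y → 6 * (y * y)) μ (6 * (N * N)) (mean-6y² N) (spread-6y² N) d
                   (λ _ q → 6 * dot q q) (λ p q → proj₂ (proj₂ (dot-coordSum 6 p q))) m K)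

  few-deviantD : 1 ≤ d → 1 ≤ N → d * length (filter deviantD? G²) ≤ 36 * (m * m) * (M * M)
  few-deviantD 1≤d 1≤N = cancel-K² 1≤d 1≤N
    (deviant-count N (λ x y → 4 * (x * y)) (N * N) (6 * (N * N)) (mean-4xy N) (spread-4xy N) d
                   (λ p q → 4 * dot p q) (λ p q → proj₁ (dot-coordSum 4 p q)) m K)

  deviants : ℕ
  deviants = length (filter deviantA? G²) + length (filter deviantB? G²) + length (filter deviantD? G²)

  few-deviants : 1 ≤ d → 1 ≤ N → d * deviants ≤ 108 * (m * m) * (M * M)
  few-deviants 1≤d 1≤N = begin
    d * deviants
      ≡⟨ spread d _ _ _ ⟩
    d * length (filter deviantA? G²) + d * length (filter deviantB? G²) + d * length (filter deviantD? G²)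
      ≤⟨ +-mono-≤ (+-mono-≤ (few-deviantA 1≤d 1≤N) (few-deviantB 1≤d 1≤N)) (few-deviantD 1≤d 1≤N) ⟩
    36 * (m * m) * (M * M) + 36 * (m * m) * (M * M) + 36 * (m * m) * (M * M)
      ≡⟨ triple (m * m) (M * M) ⟩
    108 * (m * m) * (M * M) ∎
    where
    open ≤-Reasoning
    spread : ∀ d a b c → d * (a + b + c) ≡ d * a + d * b + d * c
    spread = solve-∀
    triple : ∀ x y → 36 * x * y + 36 * x * y + 36 * x * y ≡ 108 * x * y
    triple = solve-∀

module _ (ε : ℚ) (l d N : ℕ) where
  private
    L = suc l
    m = 4 * L
  open Deviance d N m

  typical⇒sqrtNear : ∀ (p q : Pt d) → 0ℚ ≤ℚ ε → ε ≤ℚ 1ℚ → ℕ→ℚ 10 ≤ℚ ε *ℚ ε *ℚ ℕ→ℚ L → m ≤ N → 1 ≤ d → 1 ≤ N →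
    m * ∣ 6 * dot p p - d * μ ∣ ≤ K → m * ∣ 6 * dot q q - d * μ ∣ ≤ K → m * ∣ 4 * dot p q - d * (N * N) ∣ ≤ K →
    SqrtNear√7/4 (sinSq p q) ε
  typical⇒sqrtNear p q 0≤ε ε≤1 10≤εεL m≤N 1≤d 1≤N A-close B-close D-close =
    sqrtNear√7/4-sinSq ε L p q 0≤ε ε≤1 10≤εεL
      (A*B-pos m≤N A-close B-close D-close 1≤N 1≤d)
      (cos²-upper m≤N A-close B-close D-close)
      (cos²-lower m≤N A-close B-close D-close)
    where open Cos²Bounds l N d (dot p p) (dot q q) (dot p q)

  length-Ψ≤good+deviants : 0ℚ ≤ℚ ε → ε ≤ℚ 1ℚ → ℕ→ℚ 10 ≤ℚ ε *ℚ ε *ℚ ℕ→ℚ L → m ≤ N → 1 ≤ d → 1 ≤ N →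
    length (Ψ d N) ≤ length (goodΨ d N ε) + deviants
  length-Ψ≤good+deviants 0≤ε ε≤1 10≤εεL m≤N 1≤d 1≤N = begin
    length (Ψ d N)                                ≤⟨ length≤∑ (Ψ d N) (λ x _ → cover x) ⟩
    ∑[ x ∈ Ψ d N ] (𝟙 (good? x) + deviant x)      ≡⟨ ∑-distrib-+ (Ψ d N) (𝟙 ∘ good?) deviant ⟩
    ∑[ x ∈ Ψ d N ] 𝟙 (good? x) + ∑ (Ψ d N) deviant ≤⟨ +-mono-≤ (≤-reflexive (sym (length-filter≡∑𝟙 good? (Ψ d N))))
                                                                (∑-filter-≤ (inΨ? N) G² deviant) ⟩
    length (goodΨ d N ε) + ∑ G² deviant           ≡⟨ cong (_+_ (length (goodΨ d N ε))) split ⟩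
    length (goodΨ d N ε) + deviants               ∎
    where
    open ≤-Reasoning
    good? : (x : Pt d × Pt d) → Dec (SqrtNear√7/4 (sinSq (proj₁ x) (proj₂ x)) ε)
    good? x = sqrtNear? (sinSq (proj₁ x) (proj₂ x)) ε
    deviant : Pt d × Pt d → ℕ
    deviant x = 𝟙 (deviantA? x) + 𝟙 (deviantB? x) + 𝟙 (deviantD? x)
    cover : ∀ x → 1 ≤ 𝟙 (good? x) + deviant x
    cover (p , q) with deviantA? (p , q) | deviantB? (p , q) | deviantD? (p , q)
    ... | yes _ | _     | _     = ≤-trans (s≤s z≤n) (m≤n+m _ (𝟙 (good? (p , q))))
    ... | no _  | yes _ | _     = ≤-trans (s≤s z≤n) (m≤n+m _ (𝟙 (good? (p , q))))
    ... | no _  | no _  | yes _ = ≤-trans (s≤s z≤n) (m≤n+m _ (𝟙 (good? (p , q))))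
    ... | no ¬A | no ¬B | no ¬D =
      ≤-trans (≤-reflexive (sym (𝟙-yes (good? (p , q))
        (typical⇒sqrtNear p q 0≤ε ε≤1 10≤εεL m≤N 1≤d 1≤N (≮⇒≥ ¬A) (≮⇒≥ ¬B) (≮⇒≥ ¬D))))) (m≤m+n (𝟙 (good? (p , q))) 0)
    split : ∑ G² deviant ≡ deviants
    split = begin-equality
      ∑ G² deviant
        ≡⟨ trans (∑-distrib-+ G² (λ x → 𝟙 (deviantA? x) + 𝟙 (deviantB? x)) (𝟙 ∘ deviantD?))
                 (cong (_+ ∑ G² (𝟙 ∘ deviantD?)) (∑-distrib-+ G² (𝟙 ∘ deviantA?) (𝟙 ∘ deviantB?))) ⟩
      ∑ G² (𝟙 ∘ deviantA?) + ∑ G² (𝟙 ∘ deviantB?) + ∑ G² (𝟙 ∘ deviantD?)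
        ≡⟨ sym (cong₂ _+_ (cong₂ _+_ (length-filter≡∑𝟙 deviantA? G²) (length-filter≡∑𝟙 deviantB? G²))
                          (length-filter≡∑𝟙 deviantD? G²)) ⟩
      length (filter deviantA? G²) + length (filter deviantB? G²) + length (filter deviantD? G²) ∎

-- m = 4L with L = 10k² + 1 ≥ 10/ε² (see 10≤ε²L); 216 = 2 · 108 combines the three Chebyshev
-- bounds with |Ψ| ≥ |𝒲|²/2.
threshold : ℕ → ℕ
threshold k = 216 * k * (m * m)
  where m = 4 * suc (10 * (k * k))

216≤threshold : ∀ k₀ → 216 ≤ threshold (suc k₀)
216≤threshold k₀ = ≤-trans (≤-reflexive (sym (*-identityʳ 216)))
  (≤-trans (*-monoʳ-≤ 216 (s≤s (z≤n {k₀}))) (m≤m*n (216 * suc k₀) (m * m) {{>-nonZero (*-mono-≤ {1} {m} {1} {m} (s≤s z≤n) (s≤s z≤n))}}))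
  where m = 4 * suc (10 * (suc k₀ * suc k₀))

concentration : ∀ ε k₀ → 0ℚ ≤ℚ ε → ε ≤ℚ 1ℚ → 1ℚ ≤ℚ ε *ℚ ℕ→ℚ (suc k₀) →
  ∀ d N → threshold (suc k₀) ≤ d → threshold (suc k₀) * d ≤ N →
  (1ℚ - ε) *ℚ ℕ→ℚ (length (Ψ d N)) ≤ℚ ℕ→ℚ (length (goodΨ d N ε))
concentration ε k₀ 0≤ε ε≤1 1≤εk d N C≤d Cd≤N =
  [1-ε]ψ≤γ ε k ψ (length (goodΨ d N ε)) deviants 0≤ε 1≤εk
    (length-Ψ≤good+deviants ε l d N 0≤ε ε≤1 (10≤ε²L ε k (suc l) 0≤ε 1≤εk (n≤1+n l)) m≤N 1≤d 1≤N)
    k*deviants≤ψ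
  where
  k = suc k₀
  l = 10 * (k * k)
  m = 4 * suc l
  C = threshold k
  open Deviance d N m
  ψ = length (Ψ d N)
  216≤C : 216 ≤ C
  216≤C = 216≤threshold k₀
  C≤N : C ≤ N
  C≤N = ≤-trans (m≤m*n C d {{>-nonZero (≤-trans (s≤s z≤n) (≤-trans 216≤C C≤d))}}) Cd≤N
  1≤d : 1 ≤ d
  1≤d = ≤-trans (s≤s z≤n) (≤-trans 216≤C C≤d)
  1≤N : 1 ≤ N
  1≤N = ≤-trans (s≤s z≤n) (≤-trans 216≤C C≤N)
  m≤N : m ≤ N
  m≤N = ≤-trans (≤-trans (m≤m*n m m) (m≤n*m (m * m) (216 * k))) C≤N
  M²≤2ψ : M * M ≤ 2 * ψ
  M²≤2ψ = length-Ψ-large (≤-trans (≤ᵇ⇒≤ 4 216 _) (≤-trans 216≤C C≤N)) (≤-trans (≤ᵇ⇒≤ 8 216 _) (≤-trans 216≤C C≤d))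
  k*deviants≤ψ : k * deviants ≤ ψ
  k*deviants≤ψ = *-cancelˡ-≤ 2 (*-cancelˡ-≤ d {{>-nonZero 1≤d}} (begin
    d * (2 * (k * deviants))                ≡⟨ regroup d k deviants ⟩
    2 * k * (d * deviants)                  ≤⟨ *-monoʳ-≤ (2 * k) (few-deviants 1≤d 1≤N) ⟩
    2 * k * (108 * (m * m) * (M * M))       ≡⟨ collect k (m * m) (M * M) ⟩
    C * (M * M)                             ≤⟨ *-monoˡ-≤ (M * M) C≤d ⟩
    d * (M * M)                             ≤⟨ *-monoʳ-≤ d M²≤2ψ ⟩
    d * (2 * ψ)                             ∎))
    where
    open ≤-Reasoning
    regroup : ∀ d k b → d * (2 * (k * b)) ≡ 2 * k * (d * b)
    regroup = solve-∀
    collect : ∀ k x y → 2 * k * (108 * x * y) ≡ 216 * k * x * y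
    collect = solve-∀

theorem3 : (ε : ℚ) → 0ℚ <ℚ ε →
    ∃[ C ] (3 ≤ C × ((d N : ℕ) → C ≤ d → C * d ≤ N →
    (1ℚ - ε) *ℚ ℕ→ℚ (length (Ψ d N)) ≤ℚ ℕ→ℚ (length (goodΨ d N ε))))
theorem3 ε 0<ε = by-cases (1ℚ ℚP.≤? ε)
  where
  by-cases : Dec (1ℚ ≤ℚ ε) → ∃[ C ] (3 ≤ C × ((d N : ℕ) → C ≤ d → C * d ≤ N →
    (1ℚ - ε) *ℚ ℕ→ℚ (length (Ψ d N)) ≤ℚ ℕ→ℚ (length (goodΨ d N ε))))
  by-cases (yes 1≤ε) = 3 , ≤-refl , λ d N _ _ → [1-ε]ψ≤γ-of-1≤ε ε (length (Ψ d N)) (length (goodΨ d N ε)) 1≤ε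
  by-cases (no 1≰ε) = threshold (suc k₀) , ≤-trans (≤ᵇ⇒≤ 3 216 _) (216≤threshold k₀) ,
                      concentration ε k₀ (ℚP.<⇒≤ 0<ε) (ℚP.<⇒≤ (ℚP.≰⇒> 1≰ε)) 1≤εk
    where
    k₀ = proj₁ (positive⇒1≤ε*denominator ε 0<ε)
    1≤εk = proj₂ (positive⇒1≤ε*denominator ε 0<ε)
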